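{- Let $n\geq1$. For $v,w\in\mathfrak{S}_n$ set \[\lambda(v,w)=\#\{\mathsf{S}\subseteq[n-1]\mid \mathrm{Des}(w^{ -1}v_\mathsf{S})\subseteq\mathsf{S},\ \#\mathsf{S}\text{ odd}\}-\#\{\mathsf{S}\subseteq[n-1]\mid \mathrm{Des}(w^{ -1}v_\mathsf{S})\subseteq\mathsf{S},\ \#\mathsf{S}\text{ even}\}.\] Then the antipode $S$ of $\mathfrak{S}\mathit{Sym}$ satisfies, for every $v\in\mathfrak{S}_n$, \[S(\mathcal{F}_v)=\sum_{w\in\mathfrak{S}_n}\lambda(v,w)\,\mathcal{F}_w.\]
   Context: $\mathfrak{S}_n$ is the symmetric group on $[n]$; $u$ is written as the word $u_1\cdots u_n$, $u_i=u(i)$; permutations multiply as functions, $(uv)(i)=u(v(i))$. $\mathrm{Des}(u)=\{p\in[n-1]\mid u_p>u_{p+1}\}$. For distinct integers $a_1,\dots,a_p$, $\mathrm{st}(a_1,\dots,a_p)\in\mathfrak{S}_p$ is the permutation $u$ with $u_i<u_j\iff a_i<a_j$. For $u\in\mathfrak{S}_p,v\in\mathfrak{S}_q$, $u\times v\in\mathfrak{S}_{p+q}$ has word $u_1\cdots u_p(v_1+p)\cdots(v_q+p)$. For $\mathsf{S}=\{p_1<\dots<p_k\}\subseteq[n-1]$ and $v\in\mathfrak{S}_n$, $v_\mathsf{S}=\mathrm{st}(v_1,\dots,v_{p_1})\times\mathrm{st}(v_{p_1+1},\dots,v_{p_2})\times\cdots\times\mathrm{st}(v_{p_k+1},\dots,v_n)\in\mathfrak{S}_n$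 (so $v_\emptyset=v$). $\mathfrak{S}^{(p,q)}$ is the set of $\zeta\in\mathfrak{S}_{p+q}$ having no descent except possibly at position $p$. $\mathfrak{S}\mathit{Sym}$ is the graded $\mathbb{Q}$-vector space with basis $\{\mathcal{F}_u\mid u\in\mathfrak{S}_n,n\geq0\}$, with product $\mathcal{F}_u\cdot\mathcal{F}_v=\sum_{\zeta\in\mathfrak{S}^{(p,q)}}\mathcal{F}_{(u\times v)\zeta^{ -1}}$ for $u\in\mathfrak{S}_p,v\in\mathfrak{S}_q$, unit $\mathcal{F}_\emptyset$ (the empty permutation in $\mathfrak{S}_0$), coproduct $\Delta(\mathcal{F}_u)=\sum_{p=0}^n\mathcal{F}_{\mathrm{st}(u_1,\dots,u_p)}\otimes\mathcal{F}_{\mathrm{st}(u_{p+1},\dots,u_n)}$ and counit vanishing in positive degrees; it is a graded connected Hopf algebra (Malvenuto–Reutenauer), and $S$ denotes its antipode. -}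

module Defs where

open import Data.Nat as ℕ using (ℕ; zero; suc; _∸_; _<ᵇ_; _≡ᵇ_)
open import Data.Bool using (Bool; true; false; not; _∧_; if_then_else_)
open import Data.List using (List; []; _∷_; _++_; map; concat; concatMap; foldr; filter;
  length; take; drop; upTo)
open import Data.List.Properties using (≡-dec)
open import Data.Product using (_×_; _,_)
open import Data.Rational as ℚ using (ℚ; 0ℚ; 1ℚ)
open import Relation.Nullary.Decidable using (does)

-- Permutations of [n] are words u₁⋯uₙ (lists of naturals with values in 1..n).

range : ℕ → List ℕ
range n = map suc (upTo n)

-- u(i) for 1-based i (0 if out of range)
at : List ℕ → ℕ → ℕ
at []       _             = 0
at (x ∷ xs) zero          = 0
at (x ∷ xs) (suc zero)    = x
at (x ∷ xs) (suc (suc i)) = at xs (suc i)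

elemᵇ : ℕ → List ℕ → Bool
elemᵇ x []       = false
elemᵇ x (y ∷ ys) = (x ≡ᵇ y) Data.Bool.∨ elemᵇ x ys

-- 1-based position of x in a word (0 if absent)
pos : ℕ → List ℕ → ℕ
pos x []       = 0
pos x (y ∷ ys) = if x ≡ᵇ y then 1 else (if elemᵇ x ys then suc (pos x ys) else 0)

count : (ℕ → Bool) → List ℕ → ℕ
count P = foldr (λ x c → if P x then suc c else c) 0

st : List ℕ → List ℕ
st a = map (λ x → suc (count (λ y → y <ᵇ x) a)) a

_⊗ₚ_ : List ℕ → List ℕ → List ℕ
u ⊗ₚ v = u ++ map (λ x → x ℕ.+ length u) v

compose : List ℕ → List ℕ → List ℕ
compose u v = map (at u) v

inverse : List ℕ → List ℕ
inverse u = map (λ i → pos i u) (range (length u))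

Des : List ℕ → List ℕ
Des u = filter (λ p → at u (suc p) ℕ.<? at u p) (range (length u ∸ 1))

desSubset : List ℕ → List ℕ → Bool
desSubset u S = foldr (λ p b → elemᵇ p S ∧ b) true (Des u)

words : ℕ → ℕ → List (List ℕ)
words n zero    = [] ∷ []
words n (suc k) = concatMap (λ x → map (x ∷_) (words n k)) (range n)

distinctᵇ : List ℕ → Bool
distinctᵇ []       = true
distinctᵇ (x ∷ xs) = not (elemᵇ x xs) ∧ distinctᵇ xs

perms : ℕ → List (List ℕ)
perms n = filter (λ u → Data.Bool._≟_ (distinctᵇ u) true) (words n n)

shuffles : ℕ → ℕ → List (List ℕ)
shuffles p q = filter (λ ζ → Data.Bool._≟_ (desSubset ζ (p ∷ [])) true) (perms (p ℕ.+ q))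

subsets : List ℕ → List (List ℕ)
subsets []       = [] ∷ []
subsets (x ∷ xs) = let r = subsets xs in map (x ∷_) r ++ r

-- segments of v cut after positions p₁ < ⋯ < pₖ (offset = previous cut)
segments : List ℕ → List ℕ → ℕ → List (List ℕ)
segments v []       off = v ∷ []
segments v (p ∷ ps) off = take (p ∸ off) v ∷ segments (drop (p ∸ off) v) ps p

restrict : List ℕ → List ℕ → List ℕ
restrict v S = foldr _⊗ₚ_ [] (map st (segments v S 0))

sumℚ : List ℚ → ℚ
sumℚ = foldr ℚ._+_ 0ℚ

-- Elements of 𝔖Sym: finite formal ℚ-linear combinations of basis elements F_u
LC : Set
LC = List (ℚ × List ℕ)

F : List ℕ → LC
F u = (1ℚ , u) ∷ []

coeff : LC → List ℕ → ℚ
coeff x w = sumℚ (map (λ { (a , u) → if does (≡-dec ℕ._≟_ u w) then a else 0ℚ }) x)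

scale : ℚ → LC → LC
scale c = map (λ { (a , u) → (c ℚ.* a , u) })

-- product: F_u · F_v = Σ_{ζ ∈ 𝔖^{(p,q)}} F_{(u×v)ζ⁻¹}, extended bilinearly
mulF : List ℕ → List ℕ → LC
mulF u v = map (λ ζ → (1ℚ , compose (u ⊗ₚ v) (inverse ζ))) (shuffles (length u) (length v))

_·_ : LC → LC → LC
x · y = concatMap (λ { (a , u) → concatMap (λ { (b , v) → scale (a ℚ.* b) (mulF u v) }) y }) x

-- Antipode of the graded connected Hopf algebra 𝔖Sym: the unique linear S with
-- Σ S(F_{(1)}) F_{(2)} = ε(F_u)·1, i.e. S(F_∅) = F_∅ and for n ≥ 1
-- S(F_u) = - Σ_{p=0}^{n-1} S(F_{st(u₁…u_p)}) · F_{st(u_{p+1}…u_n)}.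
-- The first argument is fuel (≥ length of the word).
antipodeAux : ℕ → List ℕ → LC
antipodeAux zero    u        = F []
antipodeAux (suc k) []       = F []
antipodeAux (suc k) u@(_ ∷ _) =
  scale (ℚ.- 1ℚ)
    (concatMap (λ p → antipodeAux k (st (take p u)) · F (st (drop p u)))
               (upTo (length u)))

antipode : List ℕ → LC
antipode u = antipodeAux (length u) u

oddᵇ : ℕ → Bool
oddᵇ zero    = false
oddᵇ (suc k) = not (oddᵇ k)

lam : ℕ → List ℕ → List ℕ → ℚ
lam n v w = sumℚ (map (λ S → if desSubset (compose (inverse w) (restrict v S)) S
                              then (if oddᵇ (length S) then 1ℚ else ℚ.- 1ℚ)
                              else 0ℚ)
                     (subsets (range (n ∸ 1))))

rhs : ℕ → List ℕ → LC
rhs n v = map (λ w → (lam n v w , w)) (perms n)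

-- S(F_u) = −Σ_{p<n} S(F_{st(u₁⋯u_p)}) · F_{st(u_{p+1}⋯u_n)}, so the formula is proved by induction on n.
-- For x ∈ 𝔖_p, the coefficient of F_w in F_x · F_v is 1 if Des(w⁻¹(x × v)) ⊆ {p} and 0 otherwise; this forces w⁻¹x
-- to be increasing, so for fixed w only one x ∈ 𝔖_p contributes. For S ⊆ [p−1] we have
-- u_{S∪{p}} = st(u₁⋯u_p)_S × st(u_{p+1}⋯u_n), and Des(w⁻¹u_{S∪{p}}) ⊆ S ∪ {p} holds iff Des(x⁻¹ st(u₁⋯u_p)_S) ⊆ S
-- (x⁻¹ and w⁻¹ order the letters of x alike) and w⁻¹ is increasing on the right block. So the p-th term of the
-- recursion accounts, with the sign of #(S ∪ {p}), for the subsets of [n−1] with largest element p; the term p = 0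
-- accounts for S = ∅.

{-# OPTIONS --safe #-}
module Submission where

open import Defs
open import Data.Nat as ℕ using (ℕ; zero; suc; _+_; _∸_; _≤_; _<_; _<ᵇ_; _≡ᵇ_; z≤n; s≤s)
import Data.Nat.Properties as ℕP
open import Data.Bool as Bool using (Bool; true; false; _∧_; _∨_; if_then_else_)
import Data.Bool.Properties as BoolP
open import Data.List using (List; []; _∷_; _++_; map; concatMap; foldr; filter; length; take; drop; upTo; applyUpTo)
import Data.List.Properties as ListP
open import Data.List.Membership.Propositional using (_∈_; find)
open import Data.List.Membership.DecPropositional ℕ._≟_ using (_∈?_)
open import Data.List.Membership.Propositional.Properties using (∈-map⁺; ∈-map⁻; ∈-++⁺ˡ; ∈-++⁺ʳ; ∈-∃++; ∈-concatMap⁻; ∈-filter⁻)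
open import Data.List.Relation.Binary.Permutation.Propositional as ↭ using (_↭_; ↭-sym; ↭-trans; ↭-reflexive; ↭⇒↭ₛ)
import Data.List.Relation.Binary.Permutation.Propositional.Properties as ↭ₚ
import Data.List.Relation.Binary.Permutation.Setoid.Properties as ↭ₛₚ
open import Data.List.Relation.Binary.Pointwise using (Pointwise-≡⇒≡)
open import Data.List.Properties using (≡-dec)
open import Data.List.Relation.Unary.All as All using (All; []; _∷_)
import Data.List.Relation.Unary.All.Properties as AllP
open import Data.List.Relation.Unary.Any using (here; there)
open import Data.List.Relation.Unary.AllPairs as AllPairs using (AllPairs; []; _∷_)
import Data.List.Relation.Unary.AllPairs.Properties as AllPairsP
open import Data.List.Relation.Unary.Linked using (Linked; []; [-]; _∷_)
import Data.List.Relation.Unary.Linked.Properties as LinkedP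
open import Data.List.Relation.Unary.Unique.Propositional using (Unique)
import Data.List.Relation.Unary.Unique.Propositional.Properties as UniqueP
open import Data.List.Sort ℕP.≤-decTotalOrder using (sort; sort-↭; sort-↗)
open import Data.List.Relation.Unary.Sorted.TotalOrder.Properties using (↗↭↗⇒≋)
open import Data.Product using (Σ; _×_; _,_; proj₁; proj₂)
open import Data.Sum using (inj₁; inj₂)
open import Data.Empty using (⊥-elim)
open import Data.Unit using (tt)
open import Function using (_∘_; id; case_of_)
open import Relation.Nullary using (¬_; Dec; yes; no; does; ofʸ; ofⁿ)
open import Relation.Binary.PropositionalEquality
  using (_≡_; _≢_; refl; sym; trans; cong; cong₂; subst; subst₂; setoid; module ≡-Reasoning)
open import Data.Rational as ℚ using (ℚ; 0ℚ; 1ℚ)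
import Data.Rational.Properties as ℚP
open import Algebra.Bundles using (CommutativeMonoid)
open import Algebra.Properties.CommutativeSemigroup (CommutativeMonoid.commutativeSemigroup ℚP.+-0-commutativeMonoid)
  using (interchange)
open import Algebra.Properties.CommutativeSemigroup (CommutativeMonoid.commutativeSemigroup ℚP.*-1-commutativeMonoid)
  using (x∙yz≈y∙xz)

open ≡-Reasoning


T⇒≡true : ∀ {b} → Bool.T b → b ≡ true
T⇒≡true {true} _ = refl

≡true⇒T : ∀ {b} → b ≡ true → Bool.T b
≡true⇒T refl = tt

∧-true⁻ : ∀ {a b} → a ∧ b ≡ true → a ≡ true × b ≡ true
∧-true⁻ {true} {true} _ = refl , refl

≡ᵇ⇒≡ : ∀ {x y} → (x ≡ᵇ y) ≡ true → x ≡ y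
≡ᵇ⇒≡ {x} {y} e = ℕP.≡ᵇ⇒≡ x y (≡true⇒T e)

≡ᵇ-refl : ∀ x → (x ≡ᵇ x) ≡ true
≡ᵇ-refl x = T⇒≡true (ℕP.≡⇒≡ᵇ x x refl)

≢⇒≡ᵇ-false : ∀ {x y} → x ≢ y → (x ≡ᵇ y) ≡ false
≢⇒≡ᵇ-false {x} {y} x≢y with x ≡ᵇ y in eq
... | true = ⊥-elim (x≢y (≡ᵇ⇒≡ eq))
... | false = refl

<⇒<ᵇ : ∀ {x y} → x < y → (x <ᵇ y) ≡ true
<⇒<ᵇ x<y = T⇒≡true (ℕP.<⇒<ᵇ x<y)

<ᵇ⇒< : ∀ {x y} → (x <ᵇ y) ≡ true → x < y
<ᵇ⇒< {x} {y} e = ℕP.<ᵇ⇒< x y (≡true⇒T e)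

≥⇒<ᵇ-false : ∀ {x y} → y ≤ x → (x <ᵇ y) ≡ false
≥⇒<ᵇ-false {x} {y} y≤x with x <ᵇ y | ℕP.<ᵇ-reflects-< x y
... | true | ofʸ x<y = ⊥-elim (ℕP.<⇒≱ x<y y≤x)
... | false | _ = refl

<ᵇ-false⇒≥ : ∀ {x y} → (x <ᵇ y) ≡ false → y ≤ x
<ᵇ-false⇒≥ {x} {y} e with x <ᵇ y | ℕP.<ᵇ-reflects-< x y
<ᵇ-false⇒≥ refl | false | ofⁿ x≮y = ℕP.≮⇒≥ x≮y

elemᵇ⇒∈ : ∀ {x} ys → elemᵇ x ys ≡ true → x ∈ ys
elemᵇ⇒∈ {x} (y ∷ ys) e with x ≡ᵇ y in eq
... | true = here (≡ᵇ⇒≡ eq)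
... | false = there (elemᵇ⇒∈ ys e)

∈⇒elemᵇ : ∀ {x ys} → x ∈ ys → elemᵇ x ys ≡ true
∈⇒elemᵇ {x} (here refl) rewrite ≡ᵇ-refl x = refl
∈⇒elemᵇ {x} {y ∷ _} (there x∈) rewrite ∈⇒elemᵇ x∈ = BoolP.∨-zeroʳ (x ≡ᵇ y)

∉⇒elemᵇ-false : ∀ {x} ys → ¬ x ∈ ys → elemᵇ x ys ≡ false
∉⇒elemᵇ-false {x} ys x∉ with elemᵇ x ys in eq
... | true = ⊥-elim (x∉ (elemᵇ⇒∈ ys eq))
... | false = refl

elemᵇ-++ : ∀ d xs ys → elemᵇ d (xs ++ ys) ≡ elemᵇ d xs ∨ elemᵇ d ys
elemᵇ-++ d [] ys = refl
elemᵇ-++ d (x ∷ xs) ys rewrite elemᵇ-++ d xs ys = sym (BoolP.∨-assoc (d ≡ᵇ x) (elemᵇ d xs) (elemᵇ d ys))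


InRange : ℕ → ℕ → Set
InRange n t = 1 ≤ t × t ≤ n

range-suc : ∀ n → range (suc n) ≡ 1 ∷ map suc (range n)
range-suc n = cong (map suc) (cong (0 ∷_) (sym (ListP.map-upTo suc n)))

range-∷ʳ : ∀ n → range (suc n) ≡ range n ++ suc n ∷ []
range-∷ʳ n = trans (cong (map suc) (sym (ListP.upTo-∷ʳ n))) (ListP.map-++ suc (upTo n) (n ∷ []))

range-+ : ∀ p q → range (p + q) ≡ range p ++ map (_+ p) (range q)
range-+ p zero = trans (cong range (ℕP.+-identityʳ p)) (sym (ListP.++-identityʳ (range p)))
range-+ p (suc q) = begin
  range (p + suc q)                                            ≡⟨ cong range (ℕP.+-suc p q) ⟩
  range (suc (p + q))                                          ≡⟨ range-∷ʳ (p + q) ⟩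
  range (p + q) ++ suc (p + q) ∷ []                            ≡⟨ cong₂ _++_ (range-+ p q) (cong (λ z → suc z ∷ []) (ℕP.+-comm p q)) ⟩
  (range p ++ map (_+ p) (range q)) ++ map (_+ p) (suc q ∷ []) ≡⟨ ListP.++-assoc (range p) _ _ ⟩
  range p ++ (map (_+ p) (range q) ++ map (_+ p) (suc q ∷ [])) ≡⟨ cong (range p ++_) (sym (ListP.map-++ _ (range q) _)) ⟩
  range p ++ map (_+ p) (range q ++ suc q ∷ [])                ≡⟨ cong (λ l → range p ++ map (_+ p) l) (sym (range-∷ʳ q)) ⟩
  range p ++ map (_+ p) (range (suc q))                        ∎

length-range : ∀ n → length (range n) ≡ n
length-range n = trans (ListP.length-map suc (upTo n)) (ListP.length-upTo n)

take-range : ∀ {p n} → p ≤ n → take p (range n) ≡ range p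
take-range {zero} _ = refl
take-range {suc p} {suc n} (s≤s p≤n) = begin
  take (suc p) (range (suc n))  ≡⟨ cong (take (suc p)) (range-suc n) ⟩
  1 ∷ take p (map suc (range n)) ≡⟨ cong (1 ∷_) (ListP.take-map p (range n)) ⟩
  1 ∷ map suc (take p (range n)) ≡⟨ cong (λ l → 1 ∷ map suc l) (take-range p≤n) ⟩
  1 ∷ map suc (range p)          ≡⟨ sym (range-suc p) ⟩
  range (suc p)                  ∎

∈-range⁻ : ∀ {t} n → t ∈ range n → InRange n t
∈-range⁻ zero ()
∈-range⁻ {t} (suc n) t∈ with subst (t ∈_) (range-suc n) t∈
... | here refl = s≤s z≤n , s≤s z≤n
... | there t∈′ with ∈-map⁻ suc t∈′
... | s , s∈ , refl = s≤s z≤n , s≤s (proj₂ (∈-range⁻ n s∈))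

∈-range⁺ : ∀ {t} n → InRange n t → t ∈ range n
∈-range⁺ {suc zero} (suc n) _ = subst (1 ∈_) (sym (range-suc n)) (here refl)
∈-range⁺ {suc (suc t)} (suc n) (_ , s≤s t<n) =
  subst (suc (suc t) ∈_) (sym (range-suc n)) (there (∈-map⁺ suc (∈-range⁺ n (s≤s z≤n , t<n))))

range-strictlyIncreasing : ∀ n → AllPairs _<_ (range n)
range-strictlyIncreasing zero = []
range-strictlyIncreasing (suc n) = subst (AllPairs _<_) (sym (range-suc n))
  (AllP.map⁺ (All.tabulate (λ x∈ → s≤s (proj₁ (∈-range⁻ n x∈)))) ∷ AllPairsP.map⁺ (AllPairs.map s≤s (range-strictlyIncreasing n)))

Unique-resp-↭ : ∀ {xs ys : List ℕ} → xs ↭ ys → Unique xs → Unique ys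
Unique-resp-↭ p = ↭ₛₚ.Unique-resp-↭ (setoid ℕ) (↭⇒↭ₛ p)

Perm : ℕ → List ℕ → Set
Perm n u = u ↭ range n

Perm-unique : ∀ {n u} → Perm n u → Unique u
Perm-unique {n} p = Unique-resp-↭ (↭-sym p) (AllPairs.map ℕP.<⇒≢ (range-strictlyIncreasing n))

Perm-length : ∀ {n u} → Perm n u → length u ≡ n
Perm-length {n} p = trans (↭ₚ.↭-length p) (length-range n)

Perm-inRange : ∀ {n u t} → Perm n u → t ∈ u → InRange n t
Perm-inRange {n} p t∈ = ∈-range⁻ n (↭ₚ.∈-resp-↭ p t∈)

Perm-allInRange : ∀ {n u} → Perm n u → All (InRange n) u
Perm-allInRange p = All.tabulate (Perm-inRange p)

Perm-complete : ∀ {n u t} → Perm n u → InRange n t → t ∈ u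
Perm-complete {n} p r = ↭ₚ.∈-resp-↭ (↭-sym p) (∈-range⁺ n r)

inRange-length : ∀ {n u t} → Perm n u → InRange n t → InRange (length u) t
inRange-length p = subst (λ m → InRange m _) (sym (Perm-length p))

at-map : ∀ (f : ℕ → ℕ) u t → InRange (length u) t → at (map f u) t ≡ f (at u t)
at-map f (x ∷ u) (suc zero) _ = refl
at-map f (x ∷ u) (suc (suc i)) (_ , s≤s i<n) = at-map f u (suc i) (s≤s z≤n , i<n)

at-range : ∀ n t → InRange n t → at (range n) t ≡ t
at-range (suc n) (suc zero) _ = cong (λ l → at l 1) (range-suc n)
at-range (suc n) (suc (suc i)) (_ , s≤s i<n) = begin
  at (range (suc n)) (suc (suc i)) ≡⟨ cong (λ l → at l (suc (suc i))) (range-suc n) ⟩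
  at (map suc (range n)) (suc i)   ≡⟨ at-map suc (range n) (suc i) (s≤s z≤n , subst (i <_) (sym (length-range n)) i<n) ⟩
  suc (at (range n) (suc i))       ≡⟨ cong suc (at-range n (suc i) (s≤s z≤n , i<n)) ⟩
  suc (suc i)                      ∎

at-∈ : ∀ u t → InRange (length u) t → at u t ∈ u
at-∈ (x ∷ u) (suc zero) _ = here refl
at-∈ (x ∷ u) (suc (suc i)) (_ , s≤s i<n) = there (at-∈ u (suc i) (s≤s z≤n , i<n))

at-inRange : ∀ {n u} → Perm n u → ∀ t → InRange n t → InRange n (at u t)
at-inRange p t r = Perm-inRange p (at-∈ _ t (inRange-length p r))

compose-identityʳ : ∀ u → compose u (range (length u)) ≡ u
compose-identityʳ [] = refl
compose-identityʳ (x ∷ u) = begin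
  map (at (x ∷ u)) (range (suc (length u)))     ≡⟨ cong (map (at (x ∷ u))) (range-suc (length u)) ⟩
  x ∷ map (at (x ∷ u)) (map suc (range (length u))) ≡⟨ cong (x ∷_) (sym (ListP.map-∘ (range (length u)))) ⟩
  x ∷ map (at (x ∷ u) ∘ suc) (map suc (upTo (length u))) ≡⟨ cong (x ∷_) (sym (ListP.map-∘ (upTo (length u)))) ⟩
  x ∷ map (at u ∘ suc) (upTo (length u))          ≡⟨ cong (x ∷_) (ListP.map-∘ (upTo (length u))) ⟩
  x ∷ compose u (range (length u))                ≡⟨ cong (x ∷_) (compose-identityʳ u) ⟩
  x ∷ u                                           ∎

compose-identityˡ : ∀ n u → All (InRange n) u → compose (range n) u ≡ u
compose-identityˡ n u h = ListP.map-id-local (All.map (at-range n _) h)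

compose-assoc : ∀ u v w → All (InRange (length v)) w → compose u (compose v w) ≡ compose (compose u v) w
compose-assoc u v w h = trans (sym (ListP.map-∘ w)) (ListP.map-cong-local (All.map (λ r → sym (at-map (at u) v _ r)) h))

pos-head : ∀ y ys → pos y (y ∷ ys) ≡ 1
pos-head y ys rewrite ≡ᵇ-refl y = refl

pos-there : ∀ {t y} ys → t ≢ y → t ∈ ys → pos t (y ∷ ys) ≡ suc (pos t ys)
pos-there ys t≢y t∈ rewrite ≢⇒≡ᵇ-false t≢y | ∈⇒elemᵇ t∈ = refl

pos-inRange : ∀ {t} u → t ∈ u → InRange (length u) (pos t u)
pos-inRange {t} (y ∷ ys) t∈ with t ℕ.≟ y | t∈
... | yes refl | _ rewrite pos-head t ys = s≤s z≤n , s≤s z≤n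
... | no t≢y | here t≡y = ⊥-elim (t≢y t≡y)
... | no t≢y | there t∈ys rewrite pos-there ys t≢y t∈ys = s≤s z≤n , s≤s (proj₂ (pos-inRange ys t∈ys))

at-pos : ∀ {t} u → t ∈ u → at u (pos t u) ≡ t
at-pos {t} (y ∷ ys) t∈ with t ℕ.≟ y | t∈
... | yes refl | _ rewrite pos-head t ys = refl
... | no t≢y | here t≡y = ⊥-elim (t≢y t≡y)
... | no t≢y | there t∈ys rewrite pos-there ys t≢y t∈ys with pos t ys | pos-inRange ys t∈ys | at-pos ys t∈ys
-- at (y ∷ ys) only computes once pos t ys is exposed as a successor, which pos-inRange guarantees.
...   | suc _ | _ | e = e

map-pos : ∀ u → Unique u → map (λ t → pos t u) u ≡ range (length u)
map-pos [] _ = refl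
map-pos (y ∷ ys) (y∉ys ∷ u) = begin
  pos y (y ∷ ys) ∷ map (λ t → pos t (y ∷ ys)) ys
    ≡⟨ cong₂ _∷_ (pos-head y ys) (ListP.map-cong-local (All.tabulate (λ t∈ → pos-there ys (λ e → All.lookup y∉ys t∈ (sym e)) t∈))) ⟩
  1 ∷ map (λ t → suc (pos t ys)) ys       ≡⟨ cong (1 ∷_) (ListP.map-∘ ys) ⟩
  1 ∷ map suc (map (λ t → pos t ys) ys)   ≡⟨ cong (λ l → 1 ∷ map suc l) (map-pos ys u) ⟩
  1 ∷ map suc (range (length ys))         ≡⟨ sym (range-suc (length ys)) ⟩
  range (length (y ∷ ys))                 ∎

pos-at : ∀ u → Unique u → ∀ i → InRange (length u) i → pos (at u i) u ≡ i
pos-at u u! i r = begin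
  pos (at u i) u                    ≡⟨ sym (at-map (λ t → pos t u) u i r) ⟩
  at (map (λ t → pos t u) u) i      ≡⟨ cong (λ l → at l i) (map-pos u u!) ⟩
  at (range (length u)) i           ≡⟨ at-range (length u) i r ⟩
  i                                 ∎

≢-below : ∀ (g : ℕ → ℕ) {h x t} → All (λ b → g h < g b) t → x ∈ t → x ≢ h
≢-below g h<t x∈t x≡h = ℕP.<-irrefl (cong g (sym x≡h)) (All.lookup h<t x∈t)

pos-orderIso : ∀ (g : ℕ → ℕ) u → AllPairs (λ a b → g a < g b) u →
  ∀ {y z} → y ∈ u → z ∈ u → (pos z u <ᵇ pos y u) ≡ (g z <ᵇ g y)
pos-orderIso g (h ∷ t) (h<t ∷ t↗) {y} {z} y∈ z∈ with y∈ | z∈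
... | here refl | here refl rewrite pos-head h t = sym (≥⇒<ᵇ-false {g h} {g h} ℕP.≤-refl)
... | here refl | there z∈t rewrite pos-head h t | pos-there t (≢-below g h<t z∈t) z∈t =
  sym (≥⇒<ᵇ-false (ℕP.<⇒≤ (All.lookup h<t z∈t)))
... | there y∈t | here refl rewrite pos-head h t | pos-there t (≢-below g h<t y∈t) y∈t with pos y t | pos-inRange t y∈t
...   | suc _ | _ = sym (<⇒<ᵇ (All.lookup h<t y∈t))
pos-orderIso g (h ∷ t) (h<t ∷ t↗) {y} {z} y∈ z∈ | there y∈t | there z∈t
  rewrite pos-there t (≢-below g h<t z∈t) z∈t | pos-there t (≢-below g h<t y∈t) y∈t = pos-orderIso g t t↗ y∈t z∈t

at-inverse : ∀ u t → InRange (length u) t → at (inverse u) t ≡ pos t u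
at-inverse u t r =
  trans (at-map (λ i → pos i u) (range (length u)) t (subst (λ m → InRange m t) (sym (length-range (length u))) r))
        (cong (λ i → pos i u) (at-range (length u) t r))

inverse-Perm : ∀ {n u} → Perm n u → Perm n (inverse u)
inverse-Perm {n} {u} p =
  ↭-trans (↭ₚ.map⁺ (λ i → pos i u) (↭-sym (subst (λ m → u ↭ range m) (sym (Perm-length p)) p)))
          (↭-reflexive (trans (map-pos u (Perm-unique p)) (cong range (Perm-length p))))

compose-Perm : ∀ {n u v} → Perm n u → Perm n v → Perm n (compose u v)
compose-Perm {n} {u} pu pv = ↭-trans (↭ₚ.map⁺ (at u) pv)
  (↭-trans (↭-reflexive (trans (cong (λ m → map (at u) (range m)) (sym (Perm-length pu))) (compose-identityʳ u))) pu)

compose-inverseˡ : ∀ {n} u → Perm n u → compose (inverse u) u ≡ range n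
compose-inverseˡ {n} u p = begin
  map (at (inverse u)) u      ≡⟨ ListP.map-cong-local (All.map (λ r → at-inverse u _ (inRange-length p r)) (Perm-allInRange p)) ⟩
  map (λ t → pos t u) u       ≡⟨ map-pos u (Perm-unique p) ⟩
  range (length u)            ≡⟨ cong range (Perm-length p) ⟩
  range n                     ∎

compose-inverseʳ : ∀ {n} u → Perm n u → compose u (inverse u) ≡ range n
compose-inverseʳ {n} u p = begin
  map (at u) (map (λ i → pos i u) (range (length u))) ≡⟨ sym (ListP.map-∘ (range (length u))) ⟩
  map (λ i → at u (pos i u)) (range (length u))
    ≡⟨ ListP.map-id-local (All.tabulate (λ i∈ → at-pos u (Perm-complete p (subst (λ m → InRange m _) (Perm-length p) (∈-range⁻ (length u) i∈))))) ⟩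
  range (length u)                                    ≡⟨ cong range (Perm-length p) ⟩
  range n                                             ∎

allInRange-length : ∀ {n u v} → Perm n u → Perm n v → All (InRange (length u)) v
allInRange-length pu pv = All.map (inRange-length pu) (Perm-allInRange pv)

compose-inverse-swap⇒ : ∀ {n y ζ w} → Perm n y → Perm n ζ → Perm n w →
  compose y (inverse ζ) ≡ w → ζ ≡ compose (inverse w) y
compose-inverse-swap⇒ {n} {y} {ζ} {w} py pζ pw yζ⁻¹≡w = sym (begin
  compose (inverse w) y                  ≡⟨ cong (compose (inverse w)) (sym wζ≡y) ⟩
  compose (inverse w) (compose w ζ)      ≡⟨ compose-assoc (inverse w) w ζ (allInRange-length pw pζ) ⟩
  compose (compose (inverse w) w) ζ      ≡⟨ cong (λ l → compose l ζ) (compose-inverseˡ w pw) ⟩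
  compose (range n) ζ                    ≡⟨ compose-identityˡ n ζ (Perm-allInRange pζ) ⟩
  ζ                                      ∎)
  where
  wζ≡y : compose w ζ ≡ y
  wζ≡y = begin
    compose w ζ                              ≡⟨ cong (λ l → compose l ζ) (sym yζ⁻¹≡w) ⟩
    compose (compose y (inverse ζ)) ζ        ≡⟨ sym (compose-assoc y (inverse ζ) ζ (allInRange-length (inverse-Perm pζ) pζ)) ⟩
    compose y (compose (inverse ζ) ζ)        ≡⟨ cong (compose y) (compose-inverseˡ ζ pζ) ⟩
    compose y (range n)                      ≡⟨ cong (λ m → compose y (range m)) (sym (Perm-length py)) ⟩
    compose y (range (length y))             ≡⟨ compose-identityʳ y ⟩
    y                                        ∎

compose-inverse-swap⇐ : ∀ {n y ζ w} → Perm n y → Perm n ζ → Perm n w →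
  ζ ≡ compose (inverse w) y → compose y (inverse ζ) ≡ w
compose-inverse-swap⇐ {n} {y} {ζ} {w} py pζ pw ζ≡w⁻¹y = begin
  x                                       ≡⟨ sym (compose-identityˡ n x (Perm-allInRange px)) ⟩
  compose (range n) x                     ≡⟨ cong (λ l → compose l x) (sym (compose-inverseʳ w pw)) ⟩
  compose (compose w (inverse w)) x       ≡⟨ sym (compose-assoc w (inverse w) x (allInRange-length (inverse-Perm pw) px)) ⟩
  compose w (compose (inverse w) x)       ≡⟨ cong (compose w) w⁻¹x≡id ⟩
  compose w (range n)                     ≡⟨ cong (λ m → compose w (range m)) (sym (Perm-length pw)) ⟩
  compose w (range (length w))            ≡⟨ compose-identityʳ w ⟩
  w                                       ∎
  where
  x : List ℕ
  x = compose y (inverse ζ)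
  px : Perm n x
  px = compose-Perm py (inverse-Perm pζ)
  w⁻¹x≡id : compose (inverse w) x ≡ range n
  w⁻¹x≡id = begin
    compose (inverse w) (compose y (inverse ζ)) ≡⟨ compose-assoc (inverse w) y (inverse ζ) (allInRange-length py (inverse-Perm pζ)) ⟩
    compose (compose (inverse w) y) (inverse ζ) ≡⟨ cong (λ l → compose l (inverse ζ)) (sym ζ≡w⁻¹y) ⟩
    compose ζ (inverse ζ)                       ≡⟨ compose-inverseʳ ζ pζ ⟩
    range n                                     ∎

length-⊗ₚ : ∀ u v → length (u ⊗ₚ v) ≡ length u + length v
length-⊗ₚ u v = trans (ListP.length-++ u) (cong (length u +_) (ListP.length-map _ v))

⊗ₚ-Perm : ∀ {p q u v} → Perm p u → Perm q v → Perm (p + q) (u ⊗ₚ v)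
⊗ₚ-Perm {p} {q} {u} {v} pu pv = ↭-trans
  (↭ₚ.++⁺ pu (subst (λ m → map (_+ m) v ↭ map (_+ p) (range q)) (sym (Perm-length pu)) (↭ₚ.map⁺ _ pv)))
  (↭-reflexive (sym (range-+ p q)))

⊗ₚ-identityˡ : ∀ u → [] ⊗ₚ u ≡ u
⊗ₚ-identityˡ u = trans (ListP.map-cong ℕP.+-identityʳ u) (ListP.map-id u)

⊗ₚ-identityʳ : ∀ u → u ⊗ₚ [] ≡ u
⊗ₚ-identityʳ = ListP.++-identityʳ

⊗ₚ-assoc : ∀ u v w → (u ⊗ₚ v) ⊗ₚ w ≡ u ⊗ₚ (v ⊗ₚ w)
⊗ₚ-assoc u v w = begin
  (u ++ map (_+ length u) v) ++ map (_+ length (u ⊗ₚ v)) w           ≡⟨ ListP.++-assoc u _ _ ⟩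
  u ++ (map (_+ length u) v ++ map (_+ length (u ⊗ₚ v)) w)           ≡⟨ cong (λ l → u ++ (map (_+ length u) v ++ l)) shift ⟩
  u ++ (map (_+ length u) v ++ map (_+ length u) (map (_+ length v) w)) ≡⟨ cong (u ++_) (sym (ListP.map-++ _ v _)) ⟩
  u ⊗ₚ (v ⊗ₚ w)                                                       ∎
  where
  shift : map (_+ length (u ⊗ₚ v)) w ≡ map (_+ length u) (map (_+ length v) w)
  shift = trans (ListP.map-cong (λ t → trans (cong (t +_) (trans (length-⊗ₚ u v) (ℕP.+-comm (length u) (length v))))
                                             (sym (ℕP.+-assoc t (length v) (length u)))) w)
                (ListP.map-∘ w)

foldr-⊗ₚ : ∀ z us → foldr _⊗ₚ_ z us ≡ foldr _⊗ₚ_ [] us ⊗ₚ z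
foldr-⊗ₚ z [] = sym (⊗ₚ-identityˡ z)
foldr-⊗ₚ z (u ∷ us) = trans (cong (u ⊗ₚ_) (foldr-⊗ₚ z us)) (sym (⊗ₚ-assoc u (foldr _⊗ₚ_ [] us) z))

-- Descent sets

desSubsetFrom : ℕ → List ℕ → List ℕ → Bool
desSubsetFrom off [] T = true
desSubsetFrom off (a ∷ []) T = true
desSubsetFrom off (a ∷ b ∷ r) T = (if b <ᵇ a then elemᵇ (suc off) T else true) ∧ desSubsetFrom (suc off) (b ∷ r) T

filter-map-suc : ∀ {P : ℕ → Set} (P? : ∀ x → Dec (P x)) xs → filter P? (map suc xs) ≡ map suc (filter (P? ∘ suc) xs)
filter-map-suc P? [] = refl
filter-map-suc P? (x ∷ xs) with does (P? (suc x))
... | true = cong (suc x ∷_) (filter-map-suc P? xs)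
... | false = filter-map-suc P? xs

Des-∷ : ∀ a b r → Des (a ∷ b ∷ r) ≡ (if b <ᵇ a then 1 ∷ [] else []) ++ map suc (Des (b ∷ r))
Des-∷ a b r = begin
  Des (a ∷ b ∷ r)                                       ≡⟨ cong (filter P?) (range-suc (length r)) ⟩
  filter P? (1 ∷ map suc (range (length r)))            ≡⟨ head-step (b <ᵇ a) refl ⟩
  d₁ ++ filter P? (map suc (range (length r)))          ≡⟨ cong (d₁ ++_) (filter-map-suc P? (range (length r))) ⟩
  d₁ ++ map suc (filter (P? ∘ suc) (range (length r)))
    ≡⟨ cong (λ l → d₁ ++ map suc l) (trans (filter-map-suc (P? ∘ suc) (upTo (length r))) (sym (filter-map-suc Q? (upTo (length r))))) ⟩
  d₁ ++ map suc (Des (b ∷ r))                           ∎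
  where
  P? : ∀ p → Dec (at (a ∷ b ∷ r) (suc p) < at (a ∷ b ∷ r) p)
  P? p = at (a ∷ b ∷ r) (suc p) ℕ.<? at (a ∷ b ∷ r) p
  Q? : ∀ p → Dec (at (b ∷ r) (suc p) < at (b ∷ r) p)
  Q? p = at (b ∷ r) (suc p) ℕ.<? at (b ∷ r) p
  d₁ : List ℕ
  d₁ = if b <ᵇ a then 1 ∷ [] else []
  head-step : ∀ c → does (P? 1) ≡ c →
    filter P? (1 ∷ map suc (range (length r))) ≡ (if c then 1 ∷ [] else []) ++ filter P? (map suc (range (length r)))
  head-step c e with does (P? 1)
  head-step true refl | true = refl
  head-step false refl | false = refl

allShiftedIn : ℕ → List ℕ → List ℕ → Bool
allShiftedIn off T ps = foldr (λ p b → elemᵇ (off + p) T ∧ b) true ps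

allShiftedIn-++ : ∀ off T ps qs → allShiftedIn off T (ps ++ qs) ≡ allShiftedIn off T ps ∧ allShiftedIn off T qs
allShiftedIn-++ off T [] qs = refl
allShiftedIn-++ off T (p ∷ ps) qs rewrite allShiftedIn-++ off T ps qs = sym (BoolP.∧-assoc (elemᵇ (off + p) T) _ _)

allShiftedIn-map-suc : ∀ off T ps → allShiftedIn off T (map suc ps) ≡ allShiftedIn (suc off) T ps
allShiftedIn-map-suc off T [] = refl
allShiftedIn-map-suc off T (p ∷ ps) rewrite allShiftedIn-map-suc off T ps | ℕP.+-suc off p = refl

allShiftedIn-Des : ∀ off T u → allShiftedIn off T (Des u) ≡ desSubsetFrom off u T
allShiftedIn-Des off T [] = refl
allShiftedIn-Des off T (a ∷ []) = refl
allShiftedIn-Des off T (a ∷ b ∷ r) = begin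
  allShiftedIn off T (Des (a ∷ b ∷ r))                                           ≡⟨ cong (allShiftedIn off T) (Des-∷ a b r) ⟩
  allShiftedIn off T (d₁ ++ map suc (Des (b ∷ r)))                               ≡⟨ allShiftedIn-++ off T d₁ _ ⟩
  allShiftedIn off T d₁ ∧ allShiftedIn off T (map suc (Des (b ∷ r)))
    ≡⟨ cong₂ _∧_ (head-step (b <ᵇ a)) (trans (allShiftedIn-map-suc off T (Des (b ∷ r))) (allShiftedIn-Des (suc off) T (b ∷ r))) ⟩
  desSubsetFrom off (a ∷ b ∷ r) T                                                ∎
  where
  d₁ : List ℕ
  d₁ = if b <ᵇ a then 1 ∷ [] else []
  head-step : ∀ c → allShiftedIn off T (if c then 1 ∷ [] else []) ≡ (if c then elemᵇ (suc off) T else true)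
  head-step true = trans (cong (λ z → elemᵇ z T ∧ true) (ℕP.+-comm off 1)) (BoolP.∧-identityʳ _)
  head-step false = refl

desSubset≡desSubsetFrom0 : ∀ u T → desSubset u T ≡ desSubsetFrom 0 u T
desSubset≡desSubsetFrom0 u T = allShiftedIn-Des 0 T u

desSubsetFrom-++ : ∀ off u v T → 1 ≤ length u → elemᵇ (off + length u) T ≡ true →
  desSubsetFrom off (u ++ v) T ≡ desSubsetFrom off u T ∧ desSubsetFrom (off + length u) v T
desSubsetFrom-++ off (a ∷ []) [] T _ _ = refl
desSubsetFrom-++ off (a ∷ []) (b ∷ r) T _ cut∈T rewrite ℕP.+-comm off 1 | cut∈T with b <ᵇ a
... | true = refl
... | false = refl
desSubsetFrom-++ off (a ∷ c ∷ r) v T _ cut∈T = begin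
  d₁ ∧ desSubsetFrom (suc off) (c ∷ r ++ v) T
    ≡⟨ cong (d₁ ∧_) (desSubsetFrom-++ (suc off) (c ∷ r) v T (s≤s z≤n) (trans (cong (λ z → elemᵇ z T) shift) cut∈T)) ⟩
  d₁ ∧ (desSubsetFrom (suc off) (c ∷ r) T ∧ desSubsetFrom (suc off + length (c ∷ r)) v T)
    ≡⟨ sym (BoolP.∧-assoc d₁ _ _) ⟩
  desSubsetFrom off (a ∷ c ∷ r) T ∧ desSubsetFrom (suc off + length (c ∷ r)) v T
    ≡⟨ cong (λ z → desSubsetFrom off (a ∷ c ∷ r) T ∧ desSubsetFrom z v T) shift ⟩
  desSubsetFrom off (a ∷ c ∷ r) T ∧ desSubsetFrom (off + length (a ∷ c ∷ r)) v T ∎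
  where
  d₁ : Bool
  d₁ = if c <ᵇ a then elemᵇ (suc off) T else true
  shift : suc off + length (c ∷ r) ≡ off + length (a ∷ c ∷ r)
  shift = sym (ℕP.+-suc off (length (c ∷ r)))

desSubsetFrom-cong : ∀ off u T T′ → (∀ d → off < d → d < off + length u → elemᵇ d T ≡ elemᵇ d T′) →
  desSubsetFrom off u T ≡ desSubsetFrom off u T′
desSubsetFrom-cong off [] T T′ h = refl
desSubsetFrom-cong off (a ∷ []) T T′ h = refl
desSubsetFrom-cong off (a ∷ b ∷ r) T T′ h = cong₂ _∧_
  (cong (if b <ᵇ a then_else true) (h (suc off) ℕP.≤-refl (subst (suc off <_) (sym (ℕP.+-suc off (suc (length r)))) (s≤s (ℕP.m<m+n off (s≤s z≤n))))))
  (desSubsetFrom-cong (suc off) (b ∷ r) T T′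
    (λ d off<d d<end → h d (ℕP.<-trans (ℕP.n<1+n off) off<d) (subst (d <_) (sym (ℕP.+-suc off (suc (length r)))) d<end)))

desSubsetFrom-map-orderIso : ∀ off u T (f g : ℕ → ℕ) →
  (∀ {y z} → y ∈ u → z ∈ u → (f z <ᵇ f y) ≡ (g z <ᵇ g y)) →
  desSubsetFrom off (map f u) T ≡ desSubsetFrom off (map g u) T
desSubsetFrom-map-orderIso off [] T f g h = refl
desSubsetFrom-map-orderIso off (a ∷ []) T f g h = refl
desSubsetFrom-map-orderIso off (a ∷ b ∷ r) T f g h = cong₂ _∧_
  (cong (if_then elemᵇ (suc off) T else true) (h (here refl) (there (here refl))))
  (desSubsetFrom-map-orderIso (suc off) (b ∷ r) T f g (λ y∈ z∈ → h (there y∈) (there z∈)))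

noDescents⇒sorted : ∀ off u → desSubsetFrom off u [] ≡ true → Linked _≤_ u
noDescents⇒sorted off [] _ = []
noDescents⇒sorted off (a ∷ []) _ = [-]
noDescents⇒sorted off (a ∷ b ∷ r) e =
  <ᵇ-false⇒≥ (if-false (b <ᵇ a) (proj₁ split)) ∷ noDescents⇒sorted (suc off) (b ∷ r) (proj₂ split)
  where
  split : (if b <ᵇ a then false else true) ≡ true × desSubsetFrom (suc off) (b ∷ r) [] ≡ true
  split = ∧-true⁻ {if b <ᵇ a then false else true} e
  if-false : ∀ c → (if c then false else true) ≡ true → c ≡ false
  if-false false _ = refl

sorted⇒noDescents : ∀ off u → Linked _≤_ u → desSubsetFrom off u [] ≡ true
sorted⇒noDescents off [] _ = refl
sorted⇒noDescents off (a ∷ []) _ = refl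
sorted⇒noDescents off (a ∷ b ∷ r) (a≤b ∷ s) rewrite ≥⇒<ᵇ-false a≤b = sorted⇒noDescents (suc off) (b ∷ r) s

desSubset-++-cut : ∀ u v T p → length u ≡ p → 1 ≤ p → All (_< p) T →
  desSubset (u ++ v) (T ++ p ∷ []) ≡ desSubsetFrom 0 u T ∧ desSubsetFrom p v []
desSubset-++-cut u v T p |u|≡p 1≤p T<p = begin
  desSubset (u ++ v) (T ++ p ∷ [])                              ≡⟨ desSubset≡desSubsetFrom0 (u ++ v) _ ⟩
  desSubsetFrom 0 (u ++ v) (T ++ p ∷ [])
    ≡⟨ desSubsetFrom-++ 0 u v _ (subst (1 ≤_) (sym |u|≡p) 1≤p) (trans (cong (λ k → elemᵇ k (T ++ p ∷ [])) |u|≡p) p∈T+p) ⟩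
  desSubsetFrom 0 u (T ++ p ∷ []) ∧ desSubsetFrom (length u) v (T ++ p ∷ [])
    ≡⟨ cong₂ _∧_ before-cut (trans (cong (λ k → desSubsetFrom k v (T ++ p ∷ [])) |u|≡p) after-cut) ⟩
  desSubsetFrom 0 u T ∧ desSubsetFrom p v []                    ∎
  where
  p∈T+p : elemᵇ p (T ++ p ∷ []) ≡ true
  p∈T+p rewrite elemᵇ-++ p T (p ∷ []) | ≡ᵇ-refl p = BoolP.∨-zeroʳ (elemᵇ p T)
  elemᵇ-other : ∀ d → d ≢ p → elemᵇ d (T ++ p ∷ []) ≡ elemᵇ d T
  elemᵇ-other d d≢p rewrite elemᵇ-++ d T (p ∷ []) | ≢⇒≡ᵇ-false d≢p = BoolP.∨-identityʳ (elemᵇ d T)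
  before-cut : desSubsetFrom 0 u (T ++ p ∷ []) ≡ desSubsetFrom 0 u T
  before-cut = desSubsetFrom-cong 0 u _ _ (λ d _ d<|u| → elemᵇ-other d (λ { refl → ℕP.<-irrefl (sym |u|≡p) d<|u| }))
  after-cut : desSubsetFrom p v (T ++ p ∷ []) ≡ desSubsetFrom p v []
  after-cut = desSubsetFrom-cong p v _ _ (λ d p<d _ →
    trans (elemᵇ-other d (λ { refl → ℕP.<-irrefl refl p<d })) (∉⇒elemᵇ-false T (λ d∈T → ℕP.<-asym p<d (All.lookup T<p d∈T))))

-- Standardization

count-↭ : ∀ (P : ℕ → Bool) {xs ys} → xs ↭ ys → count P xs ≡ count P ys
count-↭ P ↭.refl = refl
count-↭ P (↭.prep x p) rewrite count-↭ P p = refl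
count-↭ P (↭.swap x y p) rewrite count-↭ P p with P x | P y
... | true | true = refl
... | true | false = refl
... | false | true = refl
... | false | false = refl
count-↭ P (↭.trans p q) = trans (count-↭ P p) (count-↭ P q)

count-cong : ∀ (P Q : ℕ → Bool) xs → All (λ y → P y ≡ Q y) xs → count P xs ≡ count Q xs
count-cong P Q [] _ = refl
count-cong P Q (x ∷ xs) (e ∷ h) rewrite e | count-cong P Q xs h = refl

count-map : ∀ (P : ℕ → Bool) f xs → count P (map f xs) ≡ count (P ∘ f) xs
count-map P f [] = refl
count-map P f (x ∷ xs) rewrite count-map P f xs = refl

count-none : ∀ (P : ℕ → Bool) xs → All (λ y → P y ≡ false) xs → count P xs ≡ 0
count-none P [] _ = refl
count-none P (x ∷ xs) (e ∷ h) rewrite e = count-none P xs h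

rank : List ℕ → ℕ → ℕ
rank a x = count (_<ᵇ x) a

rank-mono : ∀ a {x y} → x ≤ y → rank a x ≤ rank a y
rank-mono [] x≤y = z≤n
rank-mono (h ∷ t) {x} {y} x≤y with h <ᵇ x in h<x | h <ᵇ y in h<y
... | true | true = s≤s (rank-mono t x≤y)
... | true | false = ⊥-elim (ℕP.<⇒≱ (ℕP.<-≤-trans (<ᵇ⇒< {h} {x} h<x) x≤y) (<ᵇ-false⇒≥ {h} {y} h<y))
... | false | true = ℕP.m≤n⇒m≤1+n (rank-mono t x≤y)
... | false | false = rank-mono t x≤y

rank-strictMono : ∀ a {x y} → x ∈ a → x < y → rank a x < rank a y
rank-strictMono (h ∷ t) {x} (here refl) x<y rewrite ≥⇒<ᵇ-false {x} {x} ℕP.≤-refl | <⇒<ᵇ x<y = s≤s (rank-mono t (ℕP.<⇒≤ x<y))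
rank-strictMono (h ∷ t) {x} {y} (there x∈) x<y with h <ᵇ x in h<x | h <ᵇ y in h<y
... | true | true = s≤s (rank-strictMono t x∈ x<y)
... | true | false = ⊥-elim (ℕP.<⇒≱ (ℕP.<-trans (<ᵇ⇒< {h} {x} h<x) x<y) (<ᵇ-false⇒≥ {h} {y} h<y))
... | false | true = ℕP.m≤n⇒m≤1+n (rank-strictMono t x∈ x<y)
... | false | false = rank-strictMono t x∈ x<y

rank-preserves-<ᵇ : ∀ a {x y} → x ∈ a → (x <ᵇ y) ≡ (suc (rank a x) <ᵇ suc (rank a y))
rank-preserves-<ᵇ a {x} {y} x∈ with x <ᵇ y in x<y
... | true = sym (<⇒<ᵇ (s≤s (rank-strictMono a x∈ (<ᵇ⇒< {x} {y} x<y))))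
... | false = sym (≥⇒<ᵇ-false (s≤s (rank-mono a (<ᵇ-false⇒≥ {x} {y} x<y))))

st-strictlyIncreasing : ∀ s → AllPairs _<_ s → st s ≡ range (length s)
st-strictlyIncreasing [] _ = refl
st-strictlyIncreasing (h ∷ t) (h<t ∷ t↗) = begin
  suc (rank (h ∷ t) h) ∷ map (λ x → suc (rank (h ∷ t) x)) t
    ≡⟨ cong₂ _∷_ (cong suc rank-head) (ListP.map-cong-local (All.map (λ h<x → cong suc (rank-tail h<x)) h<t)) ⟩
  1 ∷ map (λ x → suc (suc (rank t x))) t      ≡⟨ cong (1 ∷_) (ListP.map-∘ t) ⟩
  1 ∷ map suc (st t)                         ≡⟨ cong (λ l → 1 ∷ map suc l) (st-strictlyIncreasing t t↗) ⟩
  1 ∷ map suc (range (length t))             ≡⟨ sym (range-suc (length t)) ⟩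
  range (length (h ∷ t))                     ∎
  where
  rank-head : rank (h ∷ t) h ≡ 0
  rank-head rewrite ≥⇒<ᵇ-false {h} {h} ℕP.≤-refl = count-none (_<ᵇ h) t (All.map (λ h<x → ≥⇒<ᵇ-false (ℕP.<⇒≤ h<x)) h<t)
  rank-tail : ∀ {x} → h < x → rank (h ∷ t) x ≡ suc (rank t x)
  rank-tail h<x rewrite <⇒<ᵇ h<x = refl

sorted-unique⇒strictlyIncreasing : ∀ {s} → Linked _≤_ s → Unique s → AllPairs _<_ s
sorted-unique⇒strictlyIncreasing s↗ s! = LinkedP.Linked⇒AllPairs ℕP.<-trans (strict s↗ s!)
  where
  strict : ∀ {s} → Linked _≤_ s → Unique s → Linked _<_ s
  strict [] _ = []
  strict [-] _ = [-]
  strict (x≤y ∷ s↗) ((x≢y ∷ _) ∷ s!) = ℕP.≤∧≢⇒< x≤y x≢y ∷ strict s↗ s!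

sorted-↭⇒≡ : ∀ {xs ys} → Linked _≤_ xs → Linked _≤_ ys → xs ↭ ys → xs ≡ ys
sorted-↭⇒≡ xs↗ ys↗ xs↭ys = Pointwise-≡⇒≡ (↗↭↗⇒≋ ℕP.≤-totalOrder xs↗ ys↗ (↭⇒↭ₛ xs↭ys))

st-Perm : ∀ a → Unique a → Perm (length a) (st a)
st-Perm a a! = ↭-trans (↭ₚ.map⁺ _ (↭-sym (sort-↭ a)))
  (↭-trans (↭-reflexive (ListP.map-cong-local (All.tabulate (λ {x} _ → cong suc (count-↭ (_<ᵇ x) (↭-sym (sort-↭ a)))))))
  (↭-trans (↭-reflexive (st-strictlyIncreasing (sort a) (sorted-unique⇒strictlyIncreasing (sort-↗ a) (Unique-resp-↭ (↭-sym (sort-↭ a)) a!))))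
  (↭-reflexive (cong range (↭ₚ.↭-length (sort-↭ a))))))

st-map-orderIso : ∀ a (f g : ℕ → ℕ) → (∀ {y z} → y ∈ a → z ∈ a → (f y <ᵇ f z) ≡ (g y <ᵇ g z)) →
  st (map f a) ≡ st (map g a)
st-map-orderIso a f g h = begin
  map (λ z → suc (rank (map f a) z)) (map f a) ≡⟨ sym (ListP.map-∘ a) ⟩
  map (λ x → suc (rank (map f a) (f x))) a     ≡⟨ ListP.map-cong-local (All.tabulate (λ x∈ → cong suc (same-rank x∈))) ⟩
  map (λ x → suc (rank (map g a) (g x))) a     ≡⟨ ListP.map-∘ a ⟩
  map (λ z → suc (rank (map g a) z)) (map g a) ∎
  where
  same-rank : ∀ {x} → x ∈ a → rank (map f a) (f x) ≡ rank (map g a) (g x)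
  same-rank {x} x∈ = trans (count-map (_<ᵇ f x) f a)
    (trans (count-cong _ _ a (All.tabulate (λ y∈ → h y∈ x∈))) (sym (count-map (_<ᵇ g x) g a)))


-- The standardized restriction v_S

∈-take⇒∈ : ∀ k (v : List ℕ) {t} → t ∈ take k v → t ∈ v
∈-take⇒∈ k v t∈ = subst (_ ∈_) (ListP.take++drop≡id k v) (∈-++⁺ˡ t∈)

∈-drop⇒∈ : ∀ k (v : List ℕ) {t} → t ∈ drop k v → t ∈ v
∈-drop⇒∈ k v t∈ = subst (_ ∈_) (ListP.take++drop≡id k v) (∈-++⁺ʳ (take k v) t∈)

segments-map : ∀ (f : ℕ → ℕ) v S off → segments (map f v) S off ≡ map (map f) (segments v S off)
segments-map f v [] off = refl
segments-map f v (s ∷ S) off = cong₂ _∷_ (ListP.take-map (s ∸ off) v)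
  (trans (cong (λ l → segments l S s) (ListP.drop-map (s ∸ off) v)) (segments-map f (drop (s ∸ off) v) S s))

segments-⊆ : ∀ (v : List ℕ) S off → All (λ seg → ∀ {t} → t ∈ seg → t ∈ v) (segments v S off)
segments-⊆ v [] off = id ∷ []
segments-⊆ v (s ∷ S) off =
  ∈-take⇒∈ (s ∸ off) v ∷ All.map (λ seg⊆ {t} t∈ → ∈-drop⇒∈ (s ∸ off) v (seg⊆ t∈)) (segments-⊆ (drop (s ∸ off) v) S s)

segments-unique : ∀ v S off → Unique v → All Unique (segments v S off)
segments-unique v [] off v! = v! ∷ []
segments-unique v (s ∷ S) off v! = UniqueP.take⁺ (s ∸ off) v! ∷ segments-unique (drop (s ∸ off) v) S s (UniqueP.drop⁺ (s ∸ off) v!)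

segments-length : ∀ v S off → foldr _+_ 0 (map length (segments v S off)) ≡ length v
segments-length v [] off = ℕP.+-identityʳ (length v)
segments-length v (s ∷ S) off = begin
  length (take (s ∸ off) v) + foldr _+_ 0 (map length (segments (drop (s ∸ off) v) S s))
    ≡⟨ cong (length (take (s ∸ off) v) +_) (segments-length (drop (s ∸ off) v) S s) ⟩
  length (take (s ∸ off) v) + length (drop (s ∸ off) v) ≡⟨ sym (ListP.length-++ (take (s ∸ off) v)) ⟩
  length (take (s ∸ off) v ++ drop (s ∸ off) v)         ≡⟨ cong length (ListP.take++drop≡id (s ∸ off) v) ⟩
  length v                                              ∎

segments-∷ʳ : ∀ v S off p → AllPairs _≤_ S → All (λ s → off ≤ s × s ≤ p) S → off ≤ p →
  segments v (S ++ p ∷ []) off ≡ segments (take (p ∸ off) v) S off ++ drop (p ∸ off) v ∷ []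
segments-∷ʳ v [] off p _ _ _ = refl
segments-∷ʳ v (s ∷ S) off p (s≤S ∷ S↗) ((off≤s , s≤p) ∷ S-bounds) off≤p = begin
  take (s ∸ off) v ∷ segments (drop (s ∸ off) v) (S ++ p ∷ []) s
    ≡⟨ cong (take (s ∸ off) v ∷_) (segments-∷ʳ (drop (s ∸ off) v) S s p S↗ (All.zipWith (λ (x , (_ , y)) → x , y) (s≤S , S-bounds)) s≤p) ⟩
  take (s ∸ off) v ∷ (segments (take (p ∸ s) (drop (s ∸ off) v)) S s ++ drop (p ∸ s) (drop (s ∸ off) v) ∷ [])
    ≡⟨ cong₂ (λ l₁ l₂ → l₁ ∷ (segments l₂ S s ++ drop (p ∸ s) (drop (s ∸ off) v) ∷ [])) take-take′ take-drop′ ⟩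
  take (s ∸ off) (take (p ∸ off) v) ∷ (segments (drop (s ∸ off) (take (p ∸ off) v)) S s ++ drop (p ∸ s) (drop (s ∸ off) v) ∷ [])
    ≡⟨ cong (λ l → take (s ∸ off) (take (p ∸ off) v) ∷ (segments (drop (s ∸ off) (take (p ∸ off) v)) S s ++ l ∷ [])) drop-drop′ ⟩
  segments (take (p ∸ off) v) (s ∷ S) off ++ drop (p ∸ off) v ∷ [] ∎
  where
  split : (s ∸ off) + (p ∸ s) ≡ p ∸ off
  split = trans (sym (ℕP.+-∸-comm (p ∸ s) off≤s)) (cong (_∸ off) (ℕP.m+[n∸m]≡n s≤p))
  take-take′ : take (s ∸ off) v ≡ take (s ∸ off) (take (p ∸ off) v)
  take-take′ = sym (trans (ListP.take-take (s ∸ off) (p ∸ off) v) (cong (λ k → take k v) (ℕP.m≤n⇒m⊓n≡m (ℕP.∸-monoˡ-≤ off s≤p))))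
  take-drop′ : take (p ∸ s) (drop (s ∸ off) v) ≡ drop (s ∸ off) (take (p ∸ off) v)
  take-drop′ = trans (ListP.take-drop (p ∸ s) (s ∸ off) v) (cong (λ k → drop (s ∸ off) (take k v)) split)
  drop-drop′ : drop (p ∸ s) (drop (s ∸ off) v) ≡ drop (p ∸ off) v
  drop-drop′ = trans (ListP.drop-drop (s ∸ off) (p ∸ s) v) (cong (λ k → drop k v) split)

restrict-∷ʳ : ∀ v S p → AllPairs _≤_ S → All (_≤ p) S →
  restrict v (S ++ p ∷ []) ≡ restrict (take p v) S ⊗ₚ st (drop p v)
restrict-∷ʳ v S p S↗ S≤p = begin
  foldr _⊗ₚ_ [] (map st (segments v (S ++ p ∷ []) 0))
    ≡⟨ cong (λ l → foldr _⊗ₚ_ [] (map st l)) (segments-∷ʳ v S 0 p S↗ (All.map (z≤n ,_) S≤p) z≤n) ⟩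
  foldr _⊗ₚ_ [] (map st (segments (take p v) S 0 ++ drop p v ∷ []))
    ≡⟨ cong (foldr _⊗ₚ_ []) (ListP.map-++ st (segments (take p v) S 0) _) ⟩
  foldr _⊗ₚ_ [] (map st (segments (take p v) S 0) ++ st (drop p v) ∷ [])
    ≡⟨ ListP.foldr-++ _⊗ₚ_ [] (map st (segments (take p v) S 0)) _ ⟩
  foldr _⊗ₚ_ (st (drop p v) ⊗ₚ []) (map st (segments (take p v) S 0))
    ≡⟨ foldr-⊗ₚ _ (map st (segments (take p v) S 0)) ⟩
  restrict (take p v) S ⊗ₚ (st (drop p v) ⊗ₚ [])
    ≡⟨ cong (restrict (take p v) S ⊗ₚ_) (⊗ₚ-identityʳ (st (drop p v))) ⟩
  restrict (take p v) S ⊗ₚ st (drop p v) ∎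

restrict-Perm : ∀ v S → Unique v → Perm (length v) (restrict v S)
restrict-Perm v S v! = subst (λ m → Perm m (restrict v S)) (segments-length v S 0)
  (product-Perm (segments v S 0) (segments-unique v S 0 v!))
  where
  product-Perm : ∀ vs → All Unique vs → Perm (foldr _+_ 0 (map length vs)) (foldr _⊗ₚ_ [] (map st vs))
  product-Perm [] _ = ↭.refl
  product-Perm (v ∷ vs) (v! ∷ vs!) = ⊗ₚ-Perm (st-Perm v v!) (product-Perm vs vs!)

restrict-st : ∀ v S → Unique v → restrict (st v) S ≡ restrict v S
restrict-st v S v! = cong (foldr _⊗ₚ_ []) (begin
  map st (segments (map r v) S 0)          ≡⟨ cong (map st) (segments-map r v S 0) ⟩
  map st (map (map r) (segments v S 0))    ≡⟨ sym (ListP.map-∘ (segments v S 0)) ⟩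
  map (st ∘ map r) (segments v S 0)        ≡⟨ ListP.map-cong-local (All.map st-rank (segments-⊆ v S 0)) ⟩
  map st (segments v S 0)                  ∎)
  where
  r : ℕ → ℕ
  r x = suc (rank v x)
  st-rank : ∀ {seg} → (∀ {t} → t ∈ seg → t ∈ v) → st (map r seg) ≡ st seg
  st-rank {seg} seg⊆v = trans (st-map-orderIso seg r id (λ {_} {z} y∈ _ → sym (rank-preserves-<ᵇ v {y = z} (seg⊆v y∈))))
                              (cong st (ListP.map-id seg))

⟦_⟧ : Bool → ℚ
⟦ b ⟧ = if b then 1ℚ else 0ℚ

⟦∧⟧ : ∀ a b → ⟦ a ∧ b ⟧ ≡ ⟦ a ⟧ ℚ.* ⟦ b ⟧
⟦∧⟧ false b = sym (ℚP.*-zeroˡ ⟦ b ⟧)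
⟦∧⟧ true b = sym (ℚP.*-identityˡ ⟦ b ⟧)

*-⟦⟧ : ∀ (c : ℚ) b → c ℚ.* ⟦ b ⟧ ≡ (if b then c else 0ℚ)
*-⟦⟧ c true = ℚP.*-identityʳ c
*-⟦⟧ c false = ℚP.*-zeroʳ c

⟦⟧-*-if : ∀ a b (e : ℚ) → ⟦ a ⟧ ℚ.* (if b then e else 0ℚ) ≡ (if b ∧ a then e else 0ℚ)
⟦⟧-*-if a false e = ℚP.*-zeroʳ ⟦ a ⟧
⟦⟧-*-if true true e = ℚP.*-identityˡ e
⟦⟧-*-if false true e = ℚP.*-zeroˡ e

sumℚ-++ : ∀ xs ys → sumℚ (xs ++ ys) ≡ sumℚ xs ℚ.+ sumℚ ys
sumℚ-++ [] ys = sym (ℚP.+-identityˡ (sumℚ ys))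
sumℚ-++ (x ∷ xs) ys = trans (cong (x ℚ.+_) (sumℚ-++ xs ys)) (sym (ℚP.+-assoc x (sumℚ xs) (sumℚ ys)))

sumℚ-cong : ∀ {A : Set} {f g : A → ℚ} xs → All (λ x → f x ≡ g x) xs → sumℚ (map f xs) ≡ sumℚ (map g xs)
sumℚ-cong xs h = cong sumℚ (ListP.map-cong-local h)

sumℚ-map-++ : ∀ {A : Set} (f : A → ℚ) xs ys → sumℚ (map f (xs ++ ys)) ≡ sumℚ (map f xs) ℚ.+ sumℚ (map f ys)
sumℚ-map-++ f xs ys = trans (cong sumℚ (ListP.map-++ f xs ys)) (sumℚ-++ (map f xs) (map f ys))

sumℚ-map-∘ : ∀ {A B : Set} (f : B → ℚ) (g : A → B) xs → sumℚ (map f (map g xs)) ≡ sumℚ (map (f ∘ g) xs)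
sumℚ-map-∘ f g xs = cong sumℚ (sym (ListP.map-∘ xs))

sumℚ-concatMap : ∀ {A B : Set} (f : B → ℚ) (g : A → List B) xs →
  sumℚ (map f (concatMap g xs)) ≡ sumℚ (map (λ x → sumℚ (map f (g x))) xs)
sumℚ-concatMap f g [] = refl
sumℚ-concatMap f g (x ∷ xs) =
  trans (sumℚ-map-++ f (g x) (concatMap g xs)) (cong (sumℚ (map f (g x)) ℚ.+_) (sumℚ-concatMap f g xs))

sumℚ-zero : ∀ {A : Set} (xs : List A) → sumℚ (map (λ _ → 0ℚ) xs) ≡ 0ℚ
sumℚ-zero [] = refl
sumℚ-zero (x ∷ xs) = trans (ℚP.+-identityˡ _) (sumℚ-zero xs)

sumℚ-*ˡ : ∀ {A : Set} c (f : A → ℚ) xs → sumℚ (map (λ x → c ℚ.* f x) xs) ≡ c ℚ.* sumℚ (map f xs)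
sumℚ-*ˡ c f [] = sym (ℚP.*-zeroʳ c)
sumℚ-*ˡ c f (x ∷ xs) = trans (cong (c ℚ.* f x ℚ.+_) (sumℚ-*ˡ c f xs)) (sym (ℚP.*-distribˡ-+ c (f x) _))

sumℚ-*ʳ : ∀ {A : Set} c (f : A → ℚ) xs → sumℚ (map (λ x → f x ℚ.* c) xs) ≡ sumℚ (map f xs) ℚ.* c
sumℚ-*ʳ c f xs = trans (sumℚ-cong xs (All.tabulate (λ {x} _ → ℚP.*-comm (f x) c)))
                       (trans (sumℚ-*ˡ c f xs) (ℚP.*-comm c _))

sumℚ-neg : ∀ {A : Set} (f : A → ℚ) xs → sumℚ (map (λ x → ℚ.- f x) xs) ≡ ℚ.- sumℚ (map f xs)
sumℚ-neg f [] = refl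
sumℚ-neg f (x ∷ xs) = trans (cong (ℚ.- f x ℚ.+_) (sumℚ-neg f xs)) (sym (ℚP.neg-distrib-+ (f x) _))

sumℚ-filter : ∀ {A : Set} (f : A → ℚ) {P : A → Set} (P? : ∀ x → Dec (P x)) xs →
  sumℚ (map f (filter P? xs)) ≡ sumℚ (map (λ x → ⟦ does (P? x) ⟧ ℚ.* f x) xs)
sumℚ-filter f P? [] = refl
sumℚ-filter f P? (x ∷ xs) with does (P? x)
... | true = cong₂ ℚ._+_ (sym (ℚP.*-identityˡ (f x))) (sumℚ-filter f P? xs)
... | false = trans (sumℚ-filter f P? xs) (sym (trans (cong (ℚ._+ _) (ℚP.*-zeroˡ (f x))) (ℚP.+-identityˡ _)))

sumℚ-indicator-unique : ∀ xs h → Unique xs → sumℚ (map (λ x → ⟦ x ≡ᵇ h ⟧) xs) ≡ ⟦ elemᵇ h xs ⟧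
sumℚ-indicator-unique [] h _ = refl
sumℚ-indicator-unique (x ∷ xs) h (x∉xs ∷ xs!) with x ℕ.≟ h
... | yes refl rewrite ≡ᵇ-refl x | sumℚ-indicator-unique xs x xs! | ∉⇒elemᵇ-false xs (λ x∈ → All.lookup x∉xs x∈ refl) =
  ℚP.+-identityʳ 1ℚ
... | no x≢h rewrite ≢⇒≡ᵇ-false x≢h | ≢⇒≡ᵇ-false (x≢h ∘ sym) | sumℚ-indicator-unique xs h xs! = ℚP.+-identityˡ _

inRange-pred : ∀ {m t} → InRange (suc m) t → t ≢ suc m → InRange m t
inRange-pred (1≤t , t≤m+1) t≢m+1 with ℕP.m≤n⇒m<n∨m≡n t≤m+1
... | inj₁ (s≤s t≤m) = 1≤t , t≤m
... | inj₂ t≡m+1 = ⊥-elim (t≢m+1 t≡m+1)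

inRange-pred-all : ∀ {m xs} → All (InRange (suc m)) xs → ¬ suc m ∈ xs → All (InRange m) xs
inRange-pred-all xs⊆ m+1∉ = All.tabulate (λ t∈ → inRange-pred (All.lookup xs⊆ t∈) (λ { refl → m+1∉ t∈ }))

range-suc-↭ : ∀ m → suc m ∷ range m ↭ range (suc m)
range-suc-↭ m = ↭-trans (↭ₚ.∷↭∷ʳ (suc m) (range m)) (↭-reflexive (sym (range-∷ʳ m)))

unique-inRange⇒complement : ∀ n y → Unique y → All (InRange n) y → Σ (List ℕ) (λ z → y ++ z ↭ range n)
unique-inRange⇒complement zero [] _ _ = [] , ↭.refl
unique-inRange⇒complement zero (x ∷ y) _ ((1≤x , x≤0) ∷ _) = ⊥-elim (ℕP.<⇒≱ 1≤x x≤0)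
unique-inRange⇒complement (suc m) y y! y⊆ with suc m ∈? y
... | no m+1∉y with unique-inRange⇒complement m y y! (inRange-pred-all y⊆ m+1∉y)
...   | z , y+z↭ = suc m ∷ z , ↭-trans (↭ₚ.shift (suc m) y z) (↭-trans (↭.prep (suc m) y+z↭) (range-suc-↭ m))
unique-inRange⇒complement (suc m) y y! y⊆ | yes m+1∈y with ∈-∃++ m+1∈y
... | ys , zs , refl
  with Unique-resp-↭ (↭ₚ.shift (suc m) ys zs) y! | ↭ₚ.All-resp-↭ (↭ₚ.shift (suc m) ys zs) y⊆
... | m+1∉ ∷ rest! | _ ∷ rest⊆
  with unique-inRange⇒complement m (ys ++ zs) rest! (inRange-pred-all rest⊆ (λ m+1∈ → All.lookup m+1∉ m+1∈ refl))
... | z , rest+z↭ = z , ↭-trans (↭-reflexive (ListP.++-assoc ys (suc m ∷ zs) z))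
  (↭-trans (↭ₚ.shift (suc m) ys (zs ++ z))
  (↭-trans (↭.prep (suc m) (↭-trans (↭-reflexive (sym (ListP.++-assoc ys zs z))) rest+z↭)) (range-suc-↭ m)))

unique-inRange⇒Perm : ∀ n y → Unique y → All (InRange n) y → length y ≡ n → Perm n y
unique-inRange⇒Perm n y y! y⊆ |y|≡n with unique-inRange⇒complement n y y! y⊆
... | [] , y+[]↭ = subst (_↭ range n) (ListP.++-identityʳ y) y+[]↭
... | x ∷ z , y+z↭ = ⊥-elim (ℕP.m+1+n≢m n (begin
  n + length (x ∷ z)          ≡⟨ cong (_+ length (x ∷ z)) (sym |y|≡n) ⟩
  length y + length (x ∷ z)   ≡⟨ sym (ListP.length-++ y) ⟩
  length (y ++ x ∷ z)         ≡⟨ Perm-length y+z↭ ⟩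
  n                           ∎))

_==_ : List ℕ → List ℕ → Bool
u == w = does (≡-dec ℕ._≟_ u w)

==-refl : ∀ u → (u == u) ≡ true
==-refl u with ≡-dec ℕ._≟_ u u
... | yes _ = refl
... | no u≢u = ⊥-elim (u≢u refl)

==-≡ : ∀ {u w} → u ≡ w → (u == w) ≡ true
==-≡ {u} refl = ==-refl u

≢⇒==-false : ∀ {u w} → u ≢ w → (u == w) ≡ false
≢⇒==-false {u} {w} u≢w with ≡-dec ℕ._≟_ u w
... | yes u≡w = ⊥-elim (u≢w u≡w)
... | no _ = refl

multiplicity : List (List ℕ) → List ℕ → ℚ
multiplicity us y = sumℚ (map (λ u → ⟦ u == y ⟧) us)

multiplicity-filter : ∀ {P : List ℕ → Set} (P? : ∀ u → Dec (P u)) us y →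
  multiplicity (filter P? us) y ≡ ⟦ does (P? y) ⟧ ℚ.* multiplicity us y
multiplicity-filter P? us y = begin
  multiplicity (filter P? us) y                           ≡⟨ sumℚ-filter (λ u → ⟦ u == y ⟧) P? us ⟩
  sumℚ (map (λ u → ⟦ does (P? u) ⟧ ℚ.* ⟦ u == y ⟧) us)   ≡⟨ sumℚ-cong us (All.tabulate (λ {u} _ → test-at-y u)) ⟩
  sumℚ (map (λ u → ⟦ does (P? y) ⟧ ℚ.* ⟦ u == y ⟧) us)   ≡⟨ sumℚ-*ˡ ⟦ does (P? y) ⟧ (λ u → ⟦ u == y ⟧) us ⟩
  ⟦ does (P? y) ⟧ ℚ.* multiplicity us y                   ∎
  where
  test-at-y : ∀ u → ⟦ does (P? u) ⟧ ℚ.* ⟦ u == y ⟧ ≡ ⟦ does (P? y) ⟧ ℚ.* ⟦ u == y ⟧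
  test-at-y u with ≡-dec ℕ._≟_ u y
  ... | yes refl = refl
  ... | no _ = trans (ℚP.*-zeroʳ ⟦ does (P? u) ⟧) (sym (ℚP.*-zeroʳ ⟦ does (P? y) ⟧))

wordᵇ : ℕ → ℕ → List ℕ → Bool
wordᵇ n zero [] = true
wordᵇ n zero (_ ∷ _) = false
wordᵇ n (suc k) [] = false
wordᵇ n (suc k) (h ∷ t) = elemᵇ h (range n) ∧ wordᵇ n k t

multiplicity-∷ : ∀ x us h t → multiplicity (map (x ∷_) us) (h ∷ t) ≡ ⟦ x ≡ᵇ h ⟧ ℚ.* multiplicity us t
multiplicity-∷ x [] h t = sym (ℚP.*-zeroʳ ⟦ x ≡ᵇ h ⟧)
multiplicity-∷ x (u ∷ us) h t = begin
  ⟦ (x ≡ᵇ h) ∧ (u == t) ⟧ ℚ.+ multiplicity (map (x ∷_) us) (h ∷ t)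
    ≡⟨ cong₂ ℚ._+_ (⟦∧⟧ (x ≡ᵇ h) (u == t)) (multiplicity-∷ x us h t) ⟩
  ⟦ x ≡ᵇ h ⟧ ℚ.* ⟦ u == t ⟧ ℚ.+ ⟦ x ≡ᵇ h ⟧ ℚ.* multiplicity us t ≡⟨ sym (ℚP.*-distribˡ-+ ⟦ x ≡ᵇ h ⟧ _ _) ⟩
  ⟦ x ≡ᵇ h ⟧ ℚ.* multiplicity (u ∷ us) t                        ∎

multiplicity-∷-[] : ∀ x us → multiplicity (map (x ∷_) us) [] ≡ 0ℚ
multiplicity-∷-[] x [] = refl
multiplicity-∷-[] x (u ∷ us) = trans (ℚP.+-identityˡ _) (multiplicity-∷-[] x us)

multiplicity-words : ∀ n k y → multiplicity (words n k) y ≡ ⟦ wordᵇ n k y ⟧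
multiplicity-words n zero [] = ℚP.+-identityʳ 1ℚ
multiplicity-words n zero (h ∷ t) = refl
multiplicity-words n (suc k) y =
  trans (sumℚ-concatMap (λ u → ⟦ u == y ⟧) (λ x → map (x ∷_) (words n k)) (range n)) (by-first-letter y)
  where
  by-first-letter : ∀ y → sumℚ (map (λ x → multiplicity (map (x ∷_) (words n k)) y) (range n)) ≡ ⟦ wordᵇ n (suc k) y ⟧
  by-first-letter [] = trans (sumℚ-cong (range n) (All.tabulate (λ {x} _ → multiplicity-∷-[] x (words n k)))) (sumℚ-zero (range n))
  by-first-letter (h ∷ t) = begin
    sumℚ (map (λ x → multiplicity (map (x ∷_) (words n k)) (h ∷ t)) (range n))
      ≡⟨ sumℚ-cong (range n) (All.tabulate (λ {x} _ → multiplicity-∷ x (words n k) h t)) ⟩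
    sumℚ (map (λ x → ⟦ x ≡ᵇ h ⟧ ℚ.* multiplicity (words n k) t) (range n))
      ≡⟨ sumℚ-*ʳ (multiplicity (words n k) t) (λ x → ⟦ x ≡ᵇ h ⟧) (range n) ⟩
    sumℚ (map (λ x → ⟦ x ≡ᵇ h ⟧) (range n)) ℚ.* multiplicity (words n k) t
      ≡⟨ cong₂ ℚ._*_ (sumℚ-indicator-unique (range n) h (Perm-unique ↭.refl)) (multiplicity-words n k t) ⟩
    ⟦ elemᵇ h (range n) ⟧ ℚ.* ⟦ wordᵇ n k t ⟧ ≡⟨ sym (⟦∧⟧ (elemᵇ h (range n)) (wordᵇ n k t)) ⟩
    ⟦ wordᵇ n (suc k) (h ∷ t) ⟧              ∎

wordᵇ⇒ : ∀ n k y → wordᵇ n k y ≡ true → length y ≡ k × All (InRange n) y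
wordᵇ⇒ n zero [] _ = refl , []
wordᵇ⇒ n (suc k) (h ∷ t) e with ∧-true⁻ {elemᵇ h (range n)} e
... | h∈ , t-word with wordᵇ⇒ n k t t-word
... | |t|≡k , t⊆ = cong suc |t|≡k , ∈-range⁻ n (elemᵇ⇒∈ (range n) h∈) ∷ t⊆

inRange⇒wordᵇ : ∀ n y → All (InRange n) y → wordᵇ n (length y) y ≡ true
inRange⇒wordᵇ n [] _ = refl
inRange⇒wordᵇ n (h ∷ t) (h∈ ∷ t⊆) rewrite ∈⇒elemᵇ (∈-range⁺ n h∈) = inRange⇒wordᵇ n t t⊆

∈-words⇒wordᵇ : ∀ n k y → y ∈ words n k → wordᵇ n k y ≡ true
∈-words⇒wordᵇ n zero .[] (here refl) = refl
∈-words⇒wordᵇ n (suc k) y y∈ with find (∈-concatMap⁻ (λ h → map (h ∷_) (words n k)) {xs = range n} y∈)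
... | h , h∈ , y∈h∷words with ∈-map⁻ (h ∷_) y∈h∷words
... | t , t∈ , refl rewrite ∈⇒elemᵇ h∈ = ∈-words⇒wordᵇ n k t t∈

distinctᵇ⇒Unique : ∀ y → distinctᵇ y ≡ true → Unique y
distinctᵇ⇒Unique [] _ = []
distinctᵇ⇒Unique (x ∷ xs) e with elemᵇ x xs in x∈ᵇxs
... | false = All.tabulate (λ { t∈ refl → x∉xs t∈ }) ∷ distinctᵇ⇒Unique xs e
  where
  x∉xs : ¬ x ∈ xs
  x∉xs x∈ with trans (sym x∈ᵇxs) (∈⇒elemᵇ x∈)
  ... | ()

Unique⇒distinctᵇ : ∀ y → Unique y → distinctᵇ y ≡ true
Unique⇒distinctᵇ [] _ = refl
Unique⇒distinctᵇ (x ∷ xs) (x∉xs ∷ xs!) rewrite ∉⇒elemᵇ-false xs (λ x∈ → All.lookup x∉xs x∈ refl) = Unique⇒distinctᵇ xs xs!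

isPermᵇ : ℕ → List ℕ → Bool
isPermᵇ n y = distinctᵇ y ∧ wordᵇ n n y

isPermᵇ⇒Perm : ∀ n y → isPermᵇ n y ≡ true → Perm n y
isPermᵇ⇒Perm n y e with ∧-true⁻ {distinctᵇ y} e
... | y-distinct , y-word with wordᵇ⇒ n n y y-word
... | |y|≡n , y⊆ = unique-inRange⇒Perm n y (distinctᵇ⇒Unique y y-distinct) y⊆ |y|≡n

Perm⇒isPermᵇ : ∀ n y → Perm n y → isPermᵇ n y ≡ true
Perm⇒isPermᵇ n y p rewrite Unique⇒distinctᵇ y (Perm-unique p) =
  subst (λ m → wordᵇ n m y ≡ true) (Perm-length p) (inRange⇒wordᵇ n y (Perm-allInRange p))

does-≟-true : ∀ b → does (b Bool.≟ true) ≡ b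
does-≟-true false = refl
does-≟-true true = refl

multiplicity-perms : ∀ n y → multiplicity (perms n) y ≡ ⟦ isPermᵇ n y ⟧
multiplicity-perms n y = begin
  multiplicity (perms n) y                                  ≡⟨ multiplicity-filter (λ u → distinctᵇ u Bool.≟ true) (words n n) y ⟩
  ⟦ does (distinctᵇ y Bool.≟ true) ⟧ ℚ.* multiplicity (words n n) y
    ≡⟨ cong₂ (λ b m → ⟦ b ⟧ ℚ.* m) (does-≟-true (distinctᵇ y)) (multiplicity-words n n y) ⟩
  ⟦ distinctᵇ y ⟧ ℚ.* ⟦ wordᵇ n n y ⟧                        ≡⟨ sym (⟦∧⟧ (distinctᵇ y) (wordᵇ n n y)) ⟩
  ⟦ isPermᵇ n y ⟧                                           ∎

∈-perms⇒Perm : ∀ n y → y ∈ perms n → Perm n y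
∈-perms⇒Perm n y y∈ with ∈-filter⁻ (λ u → distinctᵇ u Bool.≟ true) {xs = words n n} y∈
... | y∈words , y-distinct with wordᵇ⇒ n n y (∈-words⇒wordᵇ n n y y∈words)
... | |y|≡n , y⊆ = unique-inRange⇒Perm n y (distinctᵇ⇒Unique y y-distinct) y⊆ |y|≡n

multiplicity-shuffles : ∀ p q y → multiplicity (shuffles p q) y ≡ ⟦ desSubset y (p ∷ []) ⟧ ℚ.* ⟦ isPermᵇ (p + q) y ⟧
multiplicity-shuffles p q y = trans (multiplicity-filter (λ ζ → desSubset ζ (p ∷ []) Bool.≟ true) (perms (p + q)) y)
  (cong₂ (λ b m → ⟦ b ⟧ ℚ.* m) (does-≟-true (desSubset y (p ∷ []))) (multiplicity-perms (p + q) y))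

∈-shuffles⇒Perm : ∀ p q ζ → ζ ∈ shuffles p q → Perm (p + q) ζ
∈-shuffles⇒Perm p q ζ ζ∈ =
  ∈-perms⇒Perm (p + q) ζ (proj₁ (∈-filter⁻ (λ ζ → desSubset ζ (p ∷ []) Bool.≟ true) {xs = perms (p + q)} ζ∈))


coeff-++ : ∀ X Y w → coeff (X ++ Y) w ≡ coeff X w ℚ.+ coeff Y w
coeff-++ [] Y w = sym (ℚP.+-identityˡ _)
coeff-++ ((a , u) ∷ X) Y w =
  trans (cong ((if u == w then a else 0ℚ) ℚ.+_) (coeff-++ X Y w)) (sym (ℚP.+-assoc (if u == w then a else 0ℚ) _ _))

coeff-concatMap : ∀ {A : Set} (f : A → LC) xs w → coeff (concatMap f xs) w ≡ sumℚ (map (λ x → coeff (f x) w) xs)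
coeff-concatMap f [] w = refl
coeff-concatMap f (x ∷ xs) w = trans (coeff-++ (f x) (concatMap f xs) w) (cong (coeff (f x) w ℚ.+_) (coeff-concatMap f xs w))

coeff-scale : ∀ c X w → coeff (scale c X) w ≡ c ℚ.* coeff X w
coeff-scale c [] w = sym (ℚP.*-zeroʳ c)
coeff-scale c ((a , u) ∷ X) w = trans (cong₂ ℚ._+_ (scale-if (u == w)) (coeff-scale c X w))
  (sym (ℚP.*-distribˡ-+ c (if u == w then a else 0ℚ) (coeff X w)))
  where
  scale-if : ∀ b → (if b then c ℚ.* a else 0ℚ) ≡ c ℚ.* (if b then a else 0ℚ)
  scale-if true = refl
  scale-if false = sym (ℚP.*-zeroʳ c)

coeff-as-sum : ∀ X w → coeff X w ≡ sumℚ (map (λ (c , u) → c ℚ.* ⟦ u == w ⟧) X)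
coeff-as-sum [] w = refl
coeff-as-sum ((c , u) ∷ X) w = cong₂ ℚ._+_ (sym (*-⟦⟧ c (u == w))) (coeff-as-sum X w)

coeff-·F : ∀ X b w → coeff (X · F b) w ≡ sumℚ (map (λ (c , y) → c ℚ.* coeff (mulF y b) w) X)
coeff-·F [] b w = refl
coeff-·F ((c , y) ∷ X) b w = begin
  coeff ((scale (c ℚ.* 1ℚ) (mulF y b) ++ []) ++ X · F b) w
    ≡⟨ coeff-++ (scale (c ℚ.* 1ℚ) (mulF y b) ++ []) (X · F b) w ⟩
  coeff (scale (c ℚ.* 1ℚ) (mulF y b) ++ []) w ℚ.+ coeff (X · F b) w
    ≡⟨ cong₂ ℚ._+_ (trans (coeff-++ (scale (c ℚ.* 1ℚ) (mulF y b)) [] w) (ℚP.+-identityʳ (coeff (scale (c ℚ.* 1ℚ) (mulF y b)) w))) (coeff-·F X b w) ⟩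
  coeff (scale (c ℚ.* 1ℚ) (mulF y b)) w ℚ.+ rest
    ≡⟨ cong (ℚ._+ rest) (trans (coeff-scale (c ℚ.* 1ℚ) (mulF y b) w) (cong (ℚ._* coeff (mulF y b) w) (ℚP.*-identityʳ c))) ⟩
  c ℚ.* coeff (mulF y b) w ℚ.+ rest ∎
  where
  rest : ℚ
  rest = sumℚ (map (λ (c , y) → c ℚ.* coeff (mulF y b) w) X)

SupportedOn : ℕ → LC → Set
SupportedOn n X = All (λ (_ , u) → Perm n u) X

scale-supported : ∀ {n} c X → SupportedOn n X → SupportedOn n (scale c X)
scale-supported c [] _ = []
scale-supported c ((a , u) ∷ X) (pu ∷ pX) = pu ∷ scale-supported c X pX

concatMap-supported : ∀ {A : Set} {n} (f : A → LC) xs → All (λ x → SupportedOn n (f x)) xs → SupportedOn n (concatMap f xs)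
concatMap-supported f [] _ = []
concatMap-supported f (x ∷ xs) (h ∷ hs) = AllP.++⁺ h (concatMap-supported f xs hs)

mulF-supported : ∀ {p q u v} → Perm p u → Perm q v → SupportedOn (p + q) (mulF u v)
mulF-supported {p} {q} {u} {v} pu pv = AllP.map⁺ (All.tabulate (λ ζ∈ →
  compose-Perm (⊗ₚ-Perm pu pv) (inverse-Perm (subst₂ (λ a c → Perm (a + c) _) (Perm-length pu) (Perm-length pv)
                                                     (∈-shuffles⇒Perm (length u) (length v) _ ζ∈)))))

·F-supported : ∀ {p q X v} → SupportedOn p X → Perm q v → SupportedOn (p + q) (X · F v)
·F-supported {X = X} {v} pX pv = concatMap-supported _ X
  (All.map (λ { {(c , u)} pu → AllP.++⁺ (scale-supported (c ℚ.* 1ℚ) (mulF u v) (mulF-supported pu pv)) [] }) pX)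

coeff-outside-support : ∀ {n} X w → SupportedOn n X → ¬ Perm n w → coeff X w ≡ 0ℚ
coeff-outside-support [] w _ _ = refl
coeff-outside-support ((a , u) ∷ X) w (pu ∷ pX) w∉Sₙ with ≡-dec ℕ._≟_ u w
... | yes refl = ⊥-elim (w∉Sₙ pu)
... | no _ = trans (ℚP.+-identityˡ _) (coeff-outside-support X w pX w∉Sₙ)

-- Only the shuffle ζ = w⁻¹(u × v) contributes F_w to F_u · F_v.
coeff-mulF : ∀ u v w → Perm (length u + length v) (u ⊗ₚ v) → Perm (length u + length v) w →
  coeff (mulF u v) w ≡ ⟦ desSubset (compose (inverse w) (u ⊗ₚ v)) (length u ∷ []) ⟧
coeff-mulF u v w puv pw = begin
  coeff (mulF u v) w                                      ≡⟨ trans (coeff-as-sum (mulF u v) w) (sumℚ-map-∘ _ _ Z) ⟩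
  sumℚ (map (λ ζ → 1ℚ ℚ.* ⟦ compose y (inverse ζ) == w ⟧) Z)
    ≡⟨ sumℚ-cong Z (All.tabulate (λ ζ∈ → trans (ℚP.*-identityˡ _) (cong ⟦_⟧ (contributes _ (∈-shuffles⇒Perm (length u) (length v) _ ζ∈))))) ⟩
  multiplicity Z ζ₀                                       ≡⟨ multiplicity-shuffles (length u) (length v) ζ₀ ⟩
  ⟦ desSubset ζ₀ (length u ∷ []) ⟧ ℚ.* ⟦ isPermᵇ N ζ₀ ⟧
    ≡⟨ cong (λ b → ⟦ desSubset ζ₀ (length u ∷ []) ⟧ ℚ.* ⟦ b ⟧) (Perm⇒isPermᵇ N ζ₀ (compose-Perm (inverse-Perm pw) puv)) ⟩
  ⟦ desSubset ζ₀ (length u ∷ []) ⟧ ℚ.* 1ℚ                 ≡⟨ ℚP.*-identityʳ _ ⟩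
  ⟦ desSubset ζ₀ (length u ∷ []) ⟧                        ∎
  where
  N : ℕ
  N = length u + length v
  y : List ℕ
  y = u ⊗ₚ v
  Z : List (List ℕ)
  Z = shuffles (length u) (length v)
  ζ₀ : List ℕ
  ζ₀ = compose (inverse w) y
  contributes : ∀ ζ → Perm N ζ → (compose y (inverse ζ) == w) ≡ (ζ == ζ₀)
  contributes ζ pζ with ≡-dec ℕ._≟_ ζ ζ₀
  ... | yes ζ≡ζ₀ = ==-≡ (compose-inverse-swap⇐ puv pζ pw ζ≡ζ₀)
  ... | no ζ≢ζ₀ = ≢⇒==-false (λ e → ζ≢ζ₀ (compose-inverse-swap⇒ puv pζ pw e))

-- Sums over subsets of [n-1], split by largest element

sumℚ-subsets-∷ʳ : ∀ (f : List ℕ → ℚ) xs y →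
  sumℚ (map f (subsets (xs ++ y ∷ []))) ≡ sumℚ (map f (subsets xs)) ℚ.+ sumℚ (map (λ S → f (S ++ y ∷ [])) (subsets xs))
sumℚ-subsets-∷ʳ f [] y = begin
  f (y ∷ []) ℚ.+ (f [] ℚ.+ 0ℚ)           ≡⟨ ℚP.+-comm (f (y ∷ [])) _ ⟩
  (f [] ℚ.+ 0ℚ) ℚ.+ f (y ∷ [])           ≡⟨ cong ((f [] ℚ.+ 0ℚ) ℚ.+_) (sym (ℚP.+-identityʳ (f (y ∷ [])))) ⟩
  (f [] ℚ.+ 0ℚ) ℚ.+ (f (y ∷ []) ℚ.+ 0ℚ) ∎
sumℚ-subsets-∷ʳ f (x ∷ xs) y = begin
  sumℚ (map f (map (x ∷_) (subsets (xs ++ y ∷ [])) ++ subsets (xs ++ y ∷ [])))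
    ≡⟨ sumℚ-map-++ f (map (x ∷_) (subsets (xs ++ y ∷ []))) _ ⟩
  sumℚ (map f (map (x ∷_) (subsets (xs ++ y ∷ [])))) ℚ.+ sumℚ (map f (subsets (xs ++ y ∷ [])))
    ≡⟨ cong₂ ℚ._+_ (trans (sumℚ-map-∘ f (x ∷_) (subsets (xs ++ y ∷ []))) (sumℚ-subsets-∷ʳ (f ∘ (x ∷_)) xs y))
                   (sumℚ-subsets-∷ʳ f xs y) ⟩
  (with-x ℚ.+ with-x-and-y) ℚ.+ (without ℚ.+ with-y)
    ≡⟨ interchange with-x with-x-and-y without with-y ⟩
  (with-x ℚ.+ without) ℚ.+ (with-x-and-y ℚ.+ with-y)
    ≡⟨ sym (cong₂ ℚ._+_ (split-by-x f) (split-by-x (λ S → f (S ++ y ∷ [])))) ⟩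
  sumℚ (map f (subsets (x ∷ xs))) ℚ.+ sumℚ (map (λ S → f (S ++ y ∷ [])) (subsets (x ∷ xs))) ∎
  where
  with-x with-x-and-y without with-y : ℚ
  with-x = sumℚ (map (λ S → f (x ∷ S)) (subsets xs))
  with-x-and-y = sumℚ (map (λ S → f (x ∷ S ++ y ∷ [])) (subsets xs))
  without = sumℚ (map f (subsets xs))
  with-y = sumℚ (map (λ S → f (S ++ y ∷ [])) (subsets xs))
  split-by-x : ∀ (g : List ℕ → ℚ) →
    sumℚ (map g (subsets (x ∷ xs))) ≡ sumℚ (map (g ∘ (x ∷_)) (subsets xs)) ℚ.+ sumℚ (map g (subsets xs))
  split-by-x g = trans (sumℚ-map-++ g (map (x ∷_) (subsets xs)) _) (cong (ℚ._+ _) (sumℚ-map-∘ g (x ∷_) (subsets xs)))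

sumℚ-subsets-range : ∀ (f : List ℕ → ℚ) j → sumℚ (map f (subsets (range j))) ≡
  f [] ℚ.+ sumℚ (map (λ p → sumℚ (map (λ S → f (S ++ suc p ∷ [])) (subsets (range p)))) (upTo j))
sumℚ-subsets-range f zero = refl
sumℚ-subsets-range f (suc j) = begin
  sumℚ (map f (subsets (range (suc j))))                ≡⟨ cong (λ l → sumℚ (map f (subsets l))) (range-∷ʳ j) ⟩
  sumℚ (map f (subsets (range j ++ suc j ∷ [])))         ≡⟨ sumℚ-subsets-∷ʳ f (range j) (suc j) ⟩
  sumℚ (map f (subsets (range j))) ℚ.+ withMax j         ≡⟨ cong (ℚ._+ withMax j) (sumℚ-subsets-range f j) ⟩
  (f [] ℚ.+ sumℚ (map withMax (upTo j))) ℚ.+ withMax j   ≡⟨ ℚP.+-assoc (f []) _ _ ⟩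
  f [] ℚ.+ (sumℚ (map withMax (upTo j)) ℚ.+ withMax j)   ≡⟨ cong (f [] ℚ.+_) (sym sum-upTo-suc) ⟩
  f [] ℚ.+ sumℚ (map withMax (upTo (suc j)))             ∎
  where
  withMax : ℕ → ℚ
  withMax p = sumℚ (map (λ S → f (S ++ suc p ∷ [])) (subsets (range p)))
  sum-upTo-suc : sumℚ (map withMax (upTo (suc j))) ≡ sumℚ (map withMax (upTo j)) ℚ.+ withMax j
  sum-upTo-suc = begin
    sumℚ (map withMax (upTo (suc j)))                   ≡⟨ cong (λ l → sumℚ (map withMax l)) (sym (ListP.upTo-∷ʳ j)) ⟩
    sumℚ (map withMax (upTo j ++ j ∷ []))               ≡⟨ sumℚ-map-++ withMax (upTo j) (j ∷ []) ⟩
    sumℚ (map withMax (upTo j)) ℚ.+ (withMax j ℚ.+ 0ℚ)  ≡⟨ cong (sumℚ (map withMax (upTo j)) ℚ.+_) (ℚP.+-identityʳ (withMax j)) ⟩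
    sumℚ (map withMax (upTo j)) ℚ.+ withMax j           ∎

subsets-All : ∀ {P : ℕ → Set} xs → All P xs → All (All P) (subsets xs)
subsets-All [] _ = [] ∷ []
subsets-All (x ∷ xs) (px ∷ pxs) = AllP.++⁺ (AllP.map⁺ (All.map (px ∷_) (subsets-All xs pxs))) (subsets-All xs pxs)

subsets-AllPairs : ∀ {R : ℕ → ℕ → Set} xs → AllPairs R xs → All (AllPairs R) (subsets xs)
subsets-AllPairs [] _ = [] ∷ []
subsets-AllPairs (x ∷ xs) (x~xs ∷ xs~) = AllP.++⁺
  (AllP.map⁺ (All.zipWith (λ (x~S , S~) → x~S ∷ S~) (subsets-All xs x~xs , subsets-AllPairs xs xs~)))
  (subsets-AllPairs xs xs~)

subsets-range-sorted-bounded : ∀ p → All (λ S → AllPairs _≤_ S × All (_≤ p) S) (subsets (range p))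
subsets-range-sorted-bounded p = All.zipWith id
  ( subsets-AllPairs (range p) (AllPairs.map ℕP.<⇒≤ (range-strictlyIncreasing p))
  , subsets-All (range p) (All.tabulate (λ s∈ → proj₂ (∈-range⁻ p s∈))))

-- For fixed w, F_w occurs in F_x · F_v (x ∈ 𝔖_p) only for x = leftFactor, the unique x with w⁻¹x increasing.
module LeftFactor {n : ℕ} (w : List ℕ) (pw : Perm n w) (p : ℕ) (p≤n : p ≤ n) where

  τ : List ℕ
  τ = inverse w

  τ∘w : ∀ t → InRange n t → at τ (at w t) ≡ t
  τ∘w t r = trans (at-inverse w (at w t) (inRange-length pw (at-inRange pw t r)))
                  (pos-at w (Perm-unique pw) t (inRange-length pw r))

  w∘τ : ∀ t → InRange n t → at w (at τ t) ≡ t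
  w∘τ t r = trans (cong (at w) (at-inverse w t (inRange-length pw r))) (at-pos w (Perm-complete pw r))

  inRange-p⇒n : ∀ {t} → InRange p t → InRange n t
  inRange-p⇒n (1≤t , t≤p) = 1≤t , ℕP.≤-trans t≤p p≤n

  prefix : List ℕ
  prefix = take p τ

  prefix≡ : prefix ≡ compose τ (range p)
  prefix≡ = begin
    take p τ                          ≡⟨ cong (take p) (sym (trans (cong (λ m → compose τ (range m)) (sym (Perm-length (inverse-Perm pw))))
                                                                  (compose-identityʳ τ))) ⟩
    take p (map (at τ) (range n))     ≡⟨ ListP.take-map p (range n) ⟩
    map (at τ) (take p (range n))     ≡⟨ cong (map (at τ)) (take-range p≤n) ⟩
    compose τ (range p)               ∎

  sortedPrefix : List ℕ
  sortedPrefix = sort prefix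

  sortedPrefix-inRange : All (InRange n) sortedPrefix
  sortedPrefix-inRange = All.tabulate (λ t∈ → Perm-inRange (inverse-Perm pw) (∈-take⇒∈ p τ (↭ₚ.∈-resp-↭ (sort-↭ prefix) t∈)))

  leftFactor : List ℕ
  leftFactor = map (at w) sortedPrefix

  τ∘leftFactor : compose τ leftFactor ≡ sortedPrefix
  τ∘leftFactor = trans (sym (ListP.map-∘ sortedPrefix)) (ListP.map-id-local (All.map (τ∘w _) sortedPrefix-inRange))

  leftFactor-Perm : Perm p leftFactor
  leftFactor-Perm = ↭-trans (↭ₚ.map⁺ (at w) (sort-↭ prefix)) (↭-reflexive (begin
    map (at w) prefix                      ≡⟨ cong (map (at w)) prefix≡ ⟩
    map (at w) (map (at τ) (range p))      ≡⟨ sym (ListP.map-∘ (range p)) ⟩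
    map (at w ∘ at τ) (range p)            ≡⟨ ListP.map-id-local (All.tabulate (λ i∈ → w∘τ _ (inRange-p⇒n (∈-range⁻ p i∈)))) ⟩
    range p                                ∎))

  increasing⇒leftFactor : ∀ x → Perm p x → desSubsetFrom 0 (compose τ x) [] ≡ true → x ≡ leftFactor
  increasing⇒leftFactor x px τx↗ = begin
    x                               ≡⟨ sym (ListP.map-id-local (All.map (λ r → w∘τ _ (inRange-p⇒n r)) (Perm-allInRange px))) ⟩
    map (at w ∘ at τ) x             ≡⟨ ListP.map-∘ x ⟩
    map (at w) (compose τ x)        ≡⟨ cong (map (at w)) (sorted-↭⇒≡ (noDescents⇒sorted 0 _ τx↗) (sort-↗ prefix) τx↭) ⟩
    leftFactor                      ∎
    where
    τx↭ : compose τ x ↭ sortedPrefix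
    τx↭ = ↭-trans (↭ₚ.map⁺ (at τ) px) (↭-trans (↭-reflexive (sym prefix≡)) (↭-sym (sort-↭ prefix)))

  increasing⇔leftFactor : ∀ x → Perm p x → desSubsetFrom 0 (compose τ x) [] ≡ (x == leftFactor)
  increasing⇔leftFactor x px with ≡-dec ℕ._≟_ x leftFactor
  ... | yes refl = trans (cong (λ l → desSubsetFrom 0 l []) τ∘leftFactor) (sorted⇒noDescents 0 sortedPrefix (sort-↗ prefix))
  ... | no x≢leftFactor with desSubsetFrom 0 (compose τ x) [] in τx↗
  ...   | true = ⊥-elim (x≢leftFactor (increasing⇒leftFactor x px τx↗))
  ...   | false = refl

  leftFactor⁻¹-orderIso : ∀ x S → Perm p x →
    desSubsetFrom 0 (compose (inverse leftFactor) x) S ≡ desSubsetFrom 0 (compose τ x) S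
  leftFactor⁻¹-orderIso x S px = desSubsetFrom-map-orderIso 0 x S (at (inverse leftFactor)) (at τ) same-order
    where
    τ-increasing : AllPairs (λ a b → at τ a < at τ b) leftFactor
    τ-increasing = AllPairsP.map⁻ (subst (AllPairs _<_) (sym τ∘leftFactor)
      (sorted-unique⇒strictlyIncreasing (sort-↗ prefix)
        (Unique-resp-↭ (↭-sym (sort-↭ prefix)) (UniqueP.take⁺ p (Perm-unique (inverse-Perm pw))))))
    same-order : ∀ {y z} → y ∈ x → z ∈ x → (at (inverse leftFactor) z <ᵇ at (inverse leftFactor) y) ≡ (at τ z <ᵇ at τ y)
    same-order {y} {z} y∈ z∈ = trans
      (cong₂ _<ᵇ_ (at-inverse leftFactor z (inRange-length leftFactor-Perm (Perm-inRange px z∈)))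
                  (at-inverse leftFactor y (inRange-length leftFactor-Perm (Perm-inRange px y∈))))
      (pos-orderIso (at τ) leftFactor τ-increasing (Perm-complete leftFactor-Perm (Perm-inRange px y∈))
                                                   (Perm-complete leftFactor-Perm (Perm-inRange px z∈)))

  rightIncreasing : List ℕ → Bool
  rightIncreasing v = desSubsetFrom p (compose τ (map (_+ p) v)) []

  descents-⊗ₚ : ∀ x v S → Perm p x → 1 ≤ p → All (_< p) S →
    desSubset (compose τ (x ⊗ₚ v)) (S ++ p ∷ []) ≡ desSubsetFrom 0 (compose τ x) S ∧ rightIncreasing v
  descents-⊗ₚ x v S px 1≤p S<p = begin
    desSubset (compose τ (x ⊗ₚ v)) (S ++ p ∷ [])
      ≡⟨ cong (λ l → desSubset l (S ++ p ∷ [])) (ListP.map-++ (at τ) x _) ⟩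
    desSubset (compose τ x ++ compose τ (map (_+ length x) v)) (S ++ p ∷ [])
      ≡⟨ cong (λ k → desSubset (compose τ x ++ compose τ (map (_+ k) v)) (S ++ p ∷ [])) (Perm-length px) ⟩
    desSubset (compose τ x ++ compose τ (map (_+ p) v)) (S ++ p ∷ [])
      ≡⟨ desSubset-++-cut (compose τ x) _ S p (trans (ListP.length-map (at τ) x) (Perm-length px)) 1≤p S<p ⟩
    desSubsetFrom 0 (compose τ x) S ∧ rightIncreasing v ∎

  coeff-·F-leftFactor : ∀ X v → SupportedOn p X → Perm (n ∸ p) v → 1 ≤ p →
    coeff (X · F v) w ≡ ⟦ rightIncreasing v ⟧ ℚ.* coeff X leftFactor
  coeff-·F-leftFactor X v pX pv 1≤p = begin
    coeff (X · F v) w                                      ≡⟨ coeff-·F X v w ⟩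
    sumℚ (map (λ (c , y) → c ℚ.* coeff (mulF y v) w) X)   ≡⟨ sumℚ-cong X (All.map (λ {(c , y)} → term c y) pX) ⟩
    sumℚ (map (λ (c , y) → r ℚ.* (c ℚ.* ⟦ y == leftFactor ⟧)) X)
      ≡⟨ sumℚ-*ˡ r (λ (c , y) → c ℚ.* ⟦ y == leftFactor ⟧) X ⟩
    r ℚ.* sumℚ (map (λ (c , y) → c ℚ.* ⟦ y == leftFactor ⟧) X) ≡⟨ cong (r ℚ.*_) (sym (coeff-as-sum X leftFactor)) ⟩
    r ℚ.* coeff X leftFactor                               ∎
    where
    r : ℚ
    r = ⟦ rightIncreasing v ⟧
    term : ∀ c y → Perm p y → c ℚ.* coeff (mulF y v) w ≡ r ℚ.* (c ℚ.* ⟦ y == leftFactor ⟧)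
    term c y py = begin
      c ℚ.* coeff (mulF y v) w
        ≡⟨ cong (c ℚ.*_) (coeff-mulF y v w (subst (λ k → Perm k (y ⊗ₚ v)) (sym |y|+|v|) (⊗ₚ-Perm py pv))
                                           (subst (λ k → Perm k w) (trans (sym (ℕP.m+[n∸m]≡n p≤n)) (sym |y|+|v|)) pw)) ⟩
      c ℚ.* ⟦ desSubset (compose τ (y ⊗ₚ v)) (length y ∷ []) ⟧
        ≡⟨ cong (λ k → c ℚ.* ⟦ desSubset (compose τ (y ⊗ₚ v)) (k ∷ []) ⟧) (Perm-length py) ⟩
      c ℚ.* ⟦ desSubset (compose τ (y ⊗ₚ v)) ([] ++ p ∷ []) ⟧
        ≡⟨ cong (λ b → c ℚ.* ⟦ b ⟧) (trans (descents-⊗ₚ y v [] py 1≤p []) (cong (_∧ rightIncreasing v) (increasing⇔leftFactor y py))) ⟩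
      c ℚ.* ⟦ (y == leftFactor) ∧ rightIncreasing v ⟧
        ≡⟨ cong (c ℚ.*_) (trans (⟦∧⟧ (y == leftFactor) (rightIncreasing v)) (ℚP.*-comm ⟦ y == leftFactor ⟧ r)) ⟩
      c ℚ.* (r ℚ.* ⟦ y == leftFactor ⟧) ≡⟨ x∙yz≈y∙xz c r ⟦ y == leftFactor ⟧ ⟩
      r ℚ.* (c ℚ.* ⟦ y == leftFactor ⟧) ∎
      where
      |y|+|v| : length y + length v ≡ p + (n ∸ p)
      |y|+|v| = cong₂ _+_ (Perm-length py) (Perm-length pv)

-- The antipode

sign : List ℕ → ℚ
sign S = if oddᵇ (length S) then 1ℚ else ℚ.- 1ℚ

sign-∷ʳ : ∀ S p → sign (S ++ p ∷ []) ≡ ℚ.- sign S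
sign-∷ʳ S p rewrite ListP.length-++ S {p ∷ []} | ℕP.+-comm (length S) 1 with oddᵇ (length S)
... | true = refl
... | false = refl

if-neg : ∀ b (e : ℚ) → (if b then ℚ.- e else 0ℚ) ≡ ℚ.- (if b then e else 0ℚ)
if-neg true e = refl
if-neg false e = refl

-1* : ∀ x → ℚ.- 1ℚ ℚ.* x ≡ ℚ.- x
-1* x = trans (sym (ℚP.neg-distribˡ-* 1ℚ x)) (cong ℚ.-_ (ℚP.*-identityˡ x))

antipodeAux-[] : ∀ k → antipodeAux k [] ≡ F []
antipodeAux-[] zero = refl
antipodeAux-[] (suc k) = refl

desSubset-0 : ∀ u → desSubset u (0 ∷ []) ≡ desSubset u []
desSubset-0 u = begin
  desSubset u (0 ∷ [])           ≡⟨ desSubset≡desSubsetFrom0 u (0 ∷ []) ⟩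
  desSubsetFrom 0 u (0 ∷ [])     ≡⟨ desSubsetFrom-cong 0 u (0 ∷ []) [] (λ { (suc d) _ _ → refl }) ⟩
  desSubsetFrom 0 u []           ≡⟨ sym (desSubset≡desSubsetFrom0 u []) ⟩
  desSubset u []                 ∎

AntipodeCoefficients : ℕ → ℕ → List ℕ → Set
AntipodeCoefficients k m u = SupportedOn m (antipodeAux k u) × (∀ w → Perm m w → coeff (antipodeAux k u) w ≡ lam m u w)

AntipodeFormula : ℕ → Set
AntipodeFormula k = ∀ m u → 1 ≤ m → m ≤ k → Perm m u → AntipodeCoefficients k m u

module AntipodeStep (k : ℕ) (IH : AntipodeFormula k) (n : ℕ) (x : ℕ) (xs : List ℕ)
                    (pu : Perm (suc n) (x ∷ xs)) (m≤k+1 : suc n ≤ suc k) where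

  u : List ℕ
  u = x ∷ xs

  m : ℕ
  m = suc n

  |u|≡m : length u ≡ m
  |u|≡m = Perm-length pu

  left right : ℕ → List ℕ
  left p = st (take p u)
  right p = st (drop p u)

  length-take : ∀ p → p ≤ m → length (take p u) ≡ p
  length-take p p≤m = trans (ListP.length-take p u) (trans (cong (p ℕ.⊓_) |u|≡m) (ℕP.m≤n⇒m⊓n≡m p≤m))

  left-Perm : ∀ p → p ≤ m → Perm p (left p)
  left-Perm p p≤m = subst (λ j → Perm j (left p)) (length-take p p≤m) (st-Perm (take p u) (UniqueP.take⁺ p (Perm-unique pu)))

  right-Perm : ∀ p → Perm (m ∸ p) (right p)
  right-Perm p = subst (λ j → Perm j (right p)) |drop|≡m∸p (st-Perm (drop p u) (UniqueP.drop⁺ p (Perm-unique pu)))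
    where
    |drop|≡m∸p : length (drop p u) ≡ m ∸ p
    |drop|≡m∸p = trans (ListP.length-drop p u) (cong (_∸ p) |u|≡m)

  term : ℕ → LC
  term p = antipodeAux k (left p) · F (right p)

  IH-left : ∀ p → suc p < m → AntipodeCoefficients k (suc p) (left (suc p))
  IH-left p p+1<m = IH (suc p) (left (suc p)) (s≤s z≤n) (ℕP.≤-pred (ℕP.≤-trans p+1<m m≤k+1)) (left-Perm (suc p) (ℕP.<⇒≤ p+1<m))

  term-supported : ∀ p → p < m → SupportedOn m (term p)
  term-supported zero _ = subst (λ X → SupportedOn m (X · F (right 0))) (sym (antipodeAux-[] k))
    (·F-supported {0} {m} {F []} {right 0} (↭.refl ∷ []) (right-Perm 0))
  term-supported (suc p) p+1<m = subst (λ j → SupportedOn j (term (suc p))) (ℕP.m+[n∸m]≡n (ℕP.<⇒≤ p+1<m))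
    (·F-supported (proj₁ (IH-left p p+1<m)) (right-Perm (suc p)))

  antipodeAux-supported : SupportedOn m (antipodeAux (suc k) u)
  antipodeAux-supported = scale-supported (ℚ.- 1ℚ) _ (concatMap-supported term (upTo (length u))
    (subst (λ l → All (λ p → SupportedOn m (term p)) (upTo l)) (sym |u|≡m) (All.map (term-supported _) (AllP.all-upTo m))))

  module _ (w : List ℕ) (pw : Perm m w) where

    τ : List ℕ
    τ = inverse w

    admissible : List ℕ → Bool
    admissible T = desSubset (compose τ (restrict u T)) T

    signed : List ℕ → ℚ
    signed T = if admissible T then sign T else 0ℚ

    withMax : ℕ → ℚ
    withMax p = sumℚ (map (λ S → if admissible (S ++ suc p ∷ []) then sign S else 0ℚ) (subsets (range p)))

    lam-by-largest : lam m u w ≡ ℚ.- ⟦ admissible [] ⟧ ℚ.+ sumℚ (map (λ p → ℚ.- withMax p) (upTo n))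
    lam-by-largest = begin
      sumℚ (map signed (subsets (range n)))
        ≡⟨ sumℚ-subsets-range signed n ⟩
      signed [] ℚ.+ sumℚ (map (λ p → sumℚ (map (λ S → signed (S ++ suc p ∷ [])) (subsets (range p)))) (upTo n))
        ≡⟨ cong₂ ℚ._+_ (signed-[] (admissible [])) (sumℚ-cong (upTo n) (All.tabulate (λ {p} _ →
             trans (sumℚ-cong (subsets (range p)) (All.tabulate (λ {S} _ → signed-∷ʳ p S))) (sumℚ-neg _ (subsets (range p)))))) ⟩
      ℚ.- ⟦ admissible [] ⟧ ℚ.+ sumℚ (map (λ p → ℚ.- withMax p) (upTo n)) ∎
      where
      signed-[] : ∀ b → (if b then ℚ.- 1ℚ else 0ℚ) ≡ ℚ.- ⟦ b ⟧
      signed-[] true = refl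
      signed-[] false = refl
      signed-∷ʳ : ∀ p S → signed (S ++ suc p ∷ []) ≡ ℚ.- (if admissible (S ++ suc p ∷ []) then sign S else 0ℚ)
      signed-∷ʳ p S = trans (cong (if admissible (S ++ suc p ∷ []) then_else 0ℚ) (sign-∷ʳ S (suc p)))
                            (if-neg (admissible (S ++ suc p ∷ [])) (sign S))

    coeff-term-0 : coeff (term 0) w ≡ ⟦ admissible [] ⟧
    coeff-term-0 = begin
      coeff (antipodeAux k [] · F (right 0)) w  ≡⟨ cong (λ X → coeff (X · F (right 0)) w) (antipodeAux-[] k) ⟩
      coeff (F [] · F (right 0)) w              ≡⟨ coeff-·F (F []) (right 0) w ⟩
      1ℚ ℚ.* coeff (mulF [] (right 0)) w ℚ.+ 0ℚ ≡⟨ trans (ℚP.+-identityʳ _) (ℚP.*-identityˡ _) ⟩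
      coeff (mulF [] (right 0)) w
        ≡⟨ coeff-mulF [] (right 0) w (subst (λ j → Perm j ([] ⊗ₚ right 0)) (sym |right0|) (⊗ₚ-Perm {0} ↭.refl (right-Perm 0)))
                                     (subst (λ j → Perm j w) (sym |right0|) pw) ⟩
      ⟦ desSubset (compose τ ([] ⊗ₚ right 0)) (0 ∷ []) ⟧ ≡⟨ cong ⟦_⟧ (desSubset-0 (compose τ ([] ⊗ₚ right 0))) ⟩
      ⟦ desSubset (compose τ ([] ⊗ₚ right 0)) [] ⟧
        ≡⟨ cong (λ l → ⟦ desSubset (compose τ l) [] ⟧) (trans (⊗ₚ-identityˡ (right 0)) (sym (⊗ₚ-identityʳ (st u)))) ⟩
      ⟦ admissible [] ⟧                         ∎
      where
      |right0| : length (right 0) ≡ m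
      |right0| = Perm-length (right-Perm 0)

    module _ (p : ℕ) (p+1<m : suc p < m) where

      open LeftFactor w pw (suc p) (ℕP.<⇒≤ p+1<m)
        using (leftFactor; leftFactor-Perm; rightIncreasing; descents-⊗ₚ; leftFactor⁻¹-orderIso; coeff-·F-leftFactor)

      leftAdmissible : List ℕ → Bool
      leftAdmissible S = desSubset (compose (inverse leftFactor) (restrict (left (suc p)) S)) S

      rightAdmissible : Bool
      rightAdmissible = rightIncreasing (right (suc p))

      admissible-∷ʳ : ∀ S → AllPairs _≤_ S → All (_≤ p) S → admissible (S ++ suc p ∷ []) ≡ leftAdmissible S ∧ rightAdmissible
      admissible-∷ʳ S S↗ S≤p = begin
        desSubset (compose τ (restrict u (S ++ suc p ∷ []))) (S ++ suc p ∷ [])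
          ≡⟨ cong (λ l → desSubset (compose τ l) (S ++ suc p ∷ [])) restrict≡ ⟩
        desSubset (compose τ (uS ⊗ₚ right (suc p))) (S ++ suc p ∷ [])
          ≡⟨ descents-⊗ₚ uS (right (suc p)) S uS-Perm (s≤s z≤n) (All.map s≤s S≤p) ⟩
        desSubsetFrom 0 (compose τ uS) S ∧ rightAdmissible
          ≡⟨ cong (_∧ rightAdmissible) (sym (leftFactor⁻¹-orderIso uS S uS-Perm)) ⟩
        desSubsetFrom 0 (compose (inverse leftFactor) uS) S ∧ rightAdmissible
          ≡⟨ cong (_∧ rightAdmissible) (sym (desSubset≡desSubsetFrom0 (compose (inverse leftFactor) uS) S)) ⟩
        leftAdmissible S ∧ rightAdmissible ∎
        where
        u! : Unique (take (suc p) u)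
        u! = UniqueP.take⁺ (suc p) (Perm-unique pu)
        uS : List ℕ
        uS = restrict (left (suc p)) S
        restrict-left : uS ≡ restrict (take (suc p) u) S
        restrict-left = restrict-st (take (suc p) u) S u!
        uS-Perm : Perm (suc p) uS
        uS-Perm = subst (Perm (suc p)) (sym restrict-left)
          (subst (λ j → Perm j (restrict (take (suc p) u) S)) (length-take (suc p) (ℕP.<⇒≤ p+1<m)) (restrict-Perm (take (suc p) u) S u!))
        restrict≡ : restrict u (S ++ suc p ∷ []) ≡ uS ⊗ₚ right (suc p)
        restrict≡ = trans (restrict-∷ʳ u S (suc p) S↗ (All.map (λ s≤p → ℕP.≤-trans s≤p (ℕP.n≤1+n p)) S≤p))
                          (cong (_⊗ₚ right (suc p)) (sym restrict-left))

      coeff-term-suc : coeff (term (suc p)) w ≡ withMax p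
      coeff-term-suc = begin
        coeff (X · F (right (suc p))) w
          ≡⟨ coeff-·F-leftFactor X (right (suc p)) (proj₁ (IH-left p p+1<m)) (right-Perm (suc p)) (s≤s z≤n) ⟩
        ⟦ rightAdmissible ⟧ ℚ.* coeff X leftFactor
          ≡⟨ cong (⟦ rightAdmissible ⟧ ℚ.*_) (proj₂ (IH-left p p+1<m) leftFactor leftFactor-Perm) ⟩
        ⟦ rightAdmissible ⟧ ℚ.* sumℚ (map leftTerm (subsets (range p)))
          ≡⟨ sym (sumℚ-*ˡ ⟦ rightAdmissible ⟧ leftTerm (subsets (range p))) ⟩
        sumℚ (map (λ S → ⟦ rightAdmissible ⟧ ℚ.* leftTerm S) (subsets (range p)))
          ≡⟨ sumℚ-cong (subsets (range p)) (All.map (λ {S} (S↗ , S≤p) → product-term S S↗ S≤p) (subsets-range-sorted-bounded p)) ⟩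
        withMax p ∎
        where
        X : LC
        X = antipodeAux k (left (suc p))
        leftTerm : List ℕ → ℚ
        leftTerm S = if leftAdmissible S then sign S else 0ℚ
        product-term : ∀ S → AllPairs _≤_ S → All (_≤ p) S →
          ⟦ rightAdmissible ⟧ ℚ.* leftTerm S ≡ (if admissible (S ++ suc p ∷ []) then sign S else 0ℚ)
        product-term S S↗ S≤p = trans (⟦⟧-*-if rightAdmissible (leftAdmissible S) (sign S))
                                      (cong (if_then sign S else 0ℚ) (sym (admissible-∷ʳ S S↗ S≤p)))

    coeff-antipodeAux : coeff (antipodeAux (suc k) u) w ≡ lam m u w
    coeff-antipodeAux = begin
      coeff (scale (ℚ.- 1ℚ) (concatMap term (upTo (length u)))) w
        ≡⟨ trans (coeff-scale (ℚ.- 1ℚ) (concatMap term (upTo (length u))) w) (-1* _) ⟩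
      ℚ.- coeff (concatMap term (upTo (length u))) w
        ≡⟨ cong (λ l → ℚ.- coeff (concatMap term (upTo l)) w) |u|≡m ⟩
      ℚ.- coeff (concatMap term (upTo m)) w
        ≡⟨ cong ℚ.-_ (coeff-concatMap term (upTo m) w) ⟩
      ℚ.- (coeff (term 0) w ℚ.+ sumℚ (map (λ p → coeff (term p) w) (applyUpTo suc n)))
        ≡⟨ cong (λ l → ℚ.- (coeff (term 0) w ℚ.+ sumℚ (map (λ p → coeff (term p) w) l))) (sym (ListP.map-upTo suc n)) ⟩
      ℚ.- (coeff (term 0) w ℚ.+ sumℚ (map (λ p → coeff (term p) w) (map suc (upTo n))))
        ≡⟨ cong (λ z → ℚ.- (coeff (term 0) w ℚ.+ z)) (sumℚ-map-∘ (λ p → coeff (term p) w) suc (upTo n)) ⟩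
      ℚ.- (coeff (term 0) w ℚ.+ sumℚ (map (λ p → coeff (term (suc p)) w) (upTo n)))
        ≡⟨ cong₂ (λ a b → ℚ.- (a ℚ.+ b)) coeff-term-0
                 (sumℚ-cong (upTo n) (All.map (λ p<n → coeff-term-suc _ (s≤s p<n)) (AllP.all-upTo n))) ⟩
      ℚ.- (⟦ admissible [] ⟧ ℚ.+ sumℚ (map withMax (upTo n)))
        ≡⟨ trans (ℚP.neg-distrib-+ ⟦ admissible [] ⟧ _) (cong (ℚ.- ⟦ admissible [] ⟧ ℚ.+_) (sym (sumℚ-neg withMax (upTo n)))) ⟩
      ℚ.- ⟦ admissible [] ⟧ ℚ.+ sumℚ (map (λ p → ℚ.- withMax p) (upTo n))
        ≡⟨ sym lam-by-largest ⟩
      lam m u w ∎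

antipodeFormula : ∀ k → AntipodeFormula k
antipodeFormula zero m u 1≤m m≤0 pu = ⊥-elim (ℕP.<⇒≱ 1≤m m≤0)
antipodeFormula (suc k) (suc n) [] _ _ pu with Perm-length pu
... | ()
antipodeFormula (suc k) (suc n) (x ∷ xs) _ m≤k+1 pu = antipodeAux-supported , coeff-antipodeAux
  where open AntipodeStep k (antipodeFormula k) n x xs pu m≤k+1

coeff-rhs : ∀ n v w → coeff (rhs n v) w ≡ ⟦ isPermᵇ n w ⟧ ℚ.* lam n v w
coeff-rhs n v w = begin
  coeff (rhs n v) w                                           ≡⟨ trans (coeff-as-sum (rhs n v) w) (sumℚ-map-∘ _ _ (perms n)) ⟩
  sumℚ (map (λ w′ → lam n v w′ ℚ.* ⟦ w′ == w ⟧) (perms n))    ≡⟨ sumℚ-cong (perms n) (All.tabulate (λ {w′} _ → at-w w′)) ⟩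
  sumℚ (map (λ w′ → ⟦ w′ == w ⟧ ℚ.* lam n v w) (perms n))     ≡⟨ sumℚ-*ʳ (lam n v w) (λ w′ → ⟦ w′ == w ⟧) (perms n) ⟩
  multiplicity (perms n) w ℚ.* lam n v w                       ≡⟨ cong (ℚ._* lam n v w) (multiplicity-perms n w) ⟩
  ⟦ isPermᵇ n w ⟧ ℚ.* lam n v w                                ∎
  where
  at-w : ∀ w′ → lam n v w′ ℚ.* ⟦ w′ == w ⟧ ≡ ⟦ w′ == w ⟧ ℚ.* lam n v w
  at-w w′ with ≡-dec ℕ._≟_ w′ w
  ... | yes refl = ℚP.*-comm (lam n v w) 1ℚ
  ... | no _ = trans (ℚP.*-zeroʳ (lam n v w′)) (sym (ℚP.*-zeroˡ (lam n v w)))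

coeff-antipode : ∀ n v → 1 ≤ n → Perm n v → ∀ w → coeff (antipode v) w ≡ ⟦ isPermᵇ n w ⟧ ℚ.* lam n v w
coeff-antipode n v 1≤n pv w
  with isPermᵇ n w in w∈Sₙ | antipodeFormula (length v) n v 1≤n (ℕP.≤-reflexive (sym (Perm-length pv))) pv
... | true | _ , coeffs = trans (coeffs w (isPermᵇ⇒Perm n w w∈Sₙ)) (sym (ℚP.*-identityˡ (lam n v w)))
... | false | supported , _ = trans (coeff-outside-support (antipode v) w supported w∉Sₙ) (sym (ℚP.*-zeroˡ (lam n v w)))
  where
  w∉Sₙ : ¬ Perm n w
  w∉Sₙ pw = case trans (sym (Perm⇒isPermᵇ n w pw)) w∈Sₙ of λ ()

theorem2p3 : (n : ℕ) → 1 ≤ n → (v : List ℕ) → v ↭ range n →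
             (w : List ℕ) → coeff (antipode v) w ≡ coeff (rhs n v) w
theorem2p3 n 1≤n v pv w = trans (coeff-antipode n v 1≤n pv w) (sym (coeff-rhs n v w))
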